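{- Let $M$ be a matroid of rank $r$ on $n$ elements and let $i,j$ be elements of $M$ that are neither loops, coloops, nor parallel. For each integer $k\ge1$ let $M_k$ be the matroid obtained from $M$ by adding $k-1$ parallel copies of each element other than $i$ and $j$. Then $\alpha(M_k;i,j)=\alpha(M;i,j)$ for all $k$, and the sequence $\beta(M_k;i,j)$ converges monotonically to $\alpha(M;i,j)$ as $k\to\infty$.
   Context: For a matroid $M$ and elements $i,j$: $b$ is the number of bases, $b_i,b_j,b_{ij}$ the numbers of bases containing $i$, $j$, both; $b_i^j=b_i-b_{ij}$, $b_j^i=b_j-b_{ij}$, $b^{ij}=b-b_i-b_j^i$. A loop lies in no basis, a coloop in every basis; non-loops $i\ne j$ are parallel if no basis contains both. $\beta(M;i,j)=\frac{b\,b_{ij}}{b_ib_j}$ and, for $i,j$ neither loops, coloops nor parallel, $\alpha(M;i,j)=\frac{b^{ij}b_{ij}}{b_i^jb_j^i}$. -}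

module Defs where

open import Data.Bool.Base using (Bool; true; false; _∧_; not; if_then_else_)
open import Data.Nat.Base using (ℕ; zero; suc; _*_; _+_; _∸_; _≡ᵇ_; _≤_)
open import Data.Fin.Base using (Fin; splitAt; remQuot; _↑ˡ_)
open import Data.Fin.Properties using (_≟_)
open import Data.Fin.Subset using (Subset; inside; outside; _∈_; _∉_; _∪_; _-_; ⁅_⁆; ∣_∣)
open import Data.Vec.Base using (Vec; []; _∷_; tabulate; lookup)
open import Data.List.Base using (List; []; _∷_; map; _++_; filter; length; allFin)
open import Data.Bool.ListAction using (any)
import Data.List.Base as L
open import Data.Sum.Base using ([_,_])
open import Data.Product.Base using (∃; _×_; proj₂)
open import Relation.Binary.PropositionalEquality using (_≡_)
open import Relation.Nullary.Decidable using (⌊_⌋; ¬?)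
open import Data.Bool.Properties using (T?)
open import Data.Integer.Base using (+_)
open import Data.Rational.Base using (ℚ; _/_; 0ℚ)

-- A (finite) matroid on the ground set Fin n, given by its family of
-- bases as a Boolean indicator on subsets of Fin n.

BasisFamily : ℕ → Set
BasisFamily n = Subset n → Bool

record IsMatroid {n : ℕ} (𝓑 : BasisFamily n) : Set where
  field
    nonempty : ∃ λ (B : Subset n) → 𝓑 B ≡ true
    exchange : ∀ (B₁ B₂ : Subset n) → 𝓑 B₁ ≡ true → 𝓑 B₂ ≡ true →
               ∀ x → x ∈ B₁ → x ∉ B₂ →
               ∃ λ y → y ∈ B₂ × y ∉ B₁ × 𝓑 ((B₁ - x) ∪ ⁅ y ⁆) ≡ true

HasRank : ∀ {n} → BasisFamily n → ℕ → Set
HasRank {n} 𝓑 r = ∀ (B : Subset n) → 𝓑 B ≡ true → ∣ B ∣ ≡ r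

allSubsets : (n : ℕ) → List (Subset n)
allSubsets zero    = [] ∷ []
allSubsets (suc n) = map (inside ∷_) (allSubsets n) ++ map (outside ∷_) (allSubsets n)

count : ∀ {n} → (Subset n → Bool) → ℕ
count {n} P = length (filter (λ S → T? (P S)) (allSubsets n))

mem : ∀ {n} → Fin n → Subset n → Bool
mem x S = lookup S x

b : ∀ {n} → BasisFamily n → ℕ
b 𝓑 = count 𝓑

bₑ : ∀ {n} → BasisFamily n → Fin n → ℕ
bₑ 𝓑 i = count (λ S → 𝓑 S ∧ mem i S)

bₑₑ : ∀ {n} → BasisFamily n → Fin n → Fin n → ℕ
bₑₑ 𝓑 i j = count (λ S → 𝓑 S ∧ mem i S ∧ mem j S)

bₑ^ : ∀ {n} → BasisFamily n → Fin n → Fin n → ℕ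
bₑ^ 𝓑 i j = bₑ 𝓑 i ∸ bₑₑ 𝓑 i j

b^ : ∀ {n} → BasisFamily n → Fin n → Fin n → ℕ
b^ 𝓑 i j = b 𝓑 ∸ bₑ 𝓑 i ∸ bₑ^ 𝓑 j i

IsLoop : ∀ {n} → BasisFamily n → Fin n → Set
IsLoop {n} 𝓑 i = ∀ (B : Subset n) → 𝓑 B ≡ true → i ∉ B

IsColoop : ∀ {n} → BasisFamily n → Fin n → Set
IsColoop {n} 𝓑 i = ∀ (B : Subset n) → 𝓑 B ≡ true → i ∈ B

Parallel : ∀ {n} → BasisFamily n → Fin n → Fin n → Set
Parallel {n} 𝓑 i j =
  (IsLoop 𝓑 i → Data.Empty.⊥) × (IsLoop 𝓑 j → Data.Empty.⊥) × (i ≡ j → Data.Empty.⊥) ×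
  (∀ (B : Subset n) → 𝓑 B ≡ true → i ∈ B → j ∉ B)
  where import Data.Empty

-- α and β (rational numbers).  frac p q = p / q, with the junk value 0
-- when q = 0 (never used under the hypotheses of the theorem).

frac : ℕ → ℕ → ℚ
frac p zero    = 0ℚ
frac p (suc q) = (+ p) / suc q

β : ∀ {n} → BasisFamily n → Fin n → Fin n → ℚ
β 𝓑 i j = frac (b 𝓑 * bₑₑ 𝓑 i j) (bₑ 𝓑 i * bₑ 𝓑 j)

α : ∀ {n} → BasisFamily n → Fin n → Fin n → ℚ
α 𝓑 i j = frac (b^ 𝓑 i j * bₑₑ 𝓑 i j) (bₑ^ 𝓑 i j * bₑ^ 𝓑 j i)

-- The first n elements are the original ones (x ↦ x ↑ˡ _); the element
-- of the second block with coordinates (c , e) (c : Fin (k ∸ 1), e : Fin L)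
-- is the c-th new copy of the e-th element of 'others'.
-- A set S is a basis of M_k iff the projection to M is injective on S and
-- its image is a basis of M.

others : ∀ {n} → Fin n → Fin n → List (Fin n)
others {n} i j = filter (λ e → ¬? (e ≟ i) Relation.Nullary.Decidable.×-dec ¬? (e ≟ j)) (allFin n)
  where import Relation.Nullary.Decidable

L : ∀ {n} → Fin n → Fin n → ℕ
L i j = length (others i j)

GroundSize : ℕ → ∀ {n} → Fin n → Fin n → ℕ
GroundSize k {n} i j = n + (k ∸ 1) * L i j

proj : ∀ k {n} (i j : Fin n) → Fin (GroundSize k i j) → Fin n
proj k {n} i j x =
  [ (λ y → y) , (λ z → L.lookup (others i j) (proj₂ (remQuot {k ∸ 1} (L i j) z))) ]
    (splitAt n x)

image : ∀ {m n} → (Fin m → Fin n) → Subset m → Subset n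
image {m} f S = tabulate λ e → any (λ x → mem x S ∧ ⌊ f x ≟ e ⌋) (allFin m)

Mk-bases : ∀ {n} → BasisFamily n → (i j : Fin n) → (k : ℕ) → BasisFamily (GroundSize k i j)
Mk-bases 𝓑 i j k S = (∣ S ∣ ≡ᵇ ∣ image (proj k i j) S ∣) ∧ 𝓑 (image (proj k i j) S)

emb : ∀ k {n} (i j : Fin n) → Fin n → Fin (GroundSize k i j)
emb k {n} i j x = x ↑ˡ ((k ∸ 1) * L i j)

-- Sort the bases T of M by whether i ∈ T and j ∈ T; call the class sizes A (neither),
-- B (i only), C (j only) and D (both).  A basis of M_k is a set mapped injectively onto a
-- basis T of M, and every element of T other than i, j has k preimages, so T lifts to
-- k ^ (r - [i ∈ T] - [j ∈ T]) bases of M_k.  The classes of M_k therefore have sizes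
-- k^r A, k^(r-1) B, k^(r-1) C, k^(r-2) D, which leaves α = AD/BC unchanged and gives
--   β(M_k) = D (D + kB + kC + k²A) / ((D + kB)(D + kC))
--          = α + D (BC - AD) (k(B + C) + D) / (BC (D + kB)(D + kC)).
-- The last fraction decreases to 0, so β(M_k) tends to α from one side.  The hypotheses on
-- i and j, via basis exchange, make B, C and D nonzero.

module Submission where

open import Data.Bool.Base using (Bool; true; false; _∧_; _∨_; not; if_then_else_)
open import Data.Bool.Properties using (T?; ∧-conicalˡ; ∧-conicalʳ; ∧-assoc; ∧-comm; ∧-zeroʳ; ∧-identityʳ; ∨-identityʳ)
open import Data.Bool.ListAction using (any; or)
open import Data.Nat.Base as ℕ using (ℕ; zero; suc; _+_; _*_; _∸_; _^_; _≡ᵇ_; _≤_; z≤n; s≤s; >-nonZero)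
open import Data.Nat.Properties hiding (_≟_; suc-injective)
open import Data.Nat.Solver using (module +-*-Solver)
open import Data.Fin.Base using (Fin; zero; suc; _↑ˡ_; _↑ʳ_; remQuot; splitAt; join)
open import Function.Base using (_∘_; id; case_of_)
open import Data.Fin.Properties using (_≟_; suc-injective; splitAt-↑ˡ; splitAt-↑ʳ; join-splitAt)
open import Data.Fin.Subset using (Subset; inside; outside; _∈_; _∉_; _∪_; _─_; ⁅_⁆) renaming (⊥ to ∅; ∣_∣ to ∣_∣ˢ)
open import Data.Fin.Subset.Properties using (∣⊥∣≡0; x∈p∪q⁺; x∈p∪q⁻; x∈p∧x∉q⇒x∈p─q; x∈⁅x⁆; x∈⁅y⁆⇒x≡y)
open import Data.Vec.Base using (Vec; []; _∷_; here; there; tabulate; lookup; _[_]≔_)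
open import Data.Vec.Properties using ([]=⇒lookup; lookup⇒[]=; lookup∘tabulate; tabulate∘lookup; tabulate-cong; lookup∘update; lookup∘update′; lookup-replicate)
import Data.List.Base as List
open import Data.List.Properties using (length-++; filter-++; map-tabulate)
open import Data.List.Membership.Propositional.Properties using (∈-filter⁻; ∈-lookup)
open import Data.Product.Base using (Σ; ∃; _×_; _,_; proj₁; proj₂)
open import Data.Sum.Base as Sum using (_⊎_; inj₁; inj₂; [_,_])
open import Data.Empty using (⊥; ⊥-elim)
open import Relation.Nullary using (¬_; yes; no; Dec)
open import Relation.Nullary.Decidable using (⌊_⌋; does; ¬?; _×-dec_)
open import Relation.Unary using (Pred; Decidable)
open import Relation.Binary.PropositionalEquality using (_≡_; _≢_; refl; sym; trans; cong; cong₂; subst; subst₂; module ≡-Reasoning)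
open import Data.Integer.Base as ℤ using ()
import Data.Integer.Properties as ℤₚ
open import Data.Rational.Base as ℚ using (ℚ; 0ℚ; _<_; _-_; ∣_∣) renaming (_≤_ to _≤ℚ_)
import Data.Rational.Properties as ℚₚ
import Data.Rational.Unnormalised.Base as ℚᵘ
import Data.Rational.Unnormalised.Properties as ℚᵘₚ
open import Algebra.Properties.Group ℚₚ.+-0-group using (⁻¹-anti-homo-∙; ⁻¹-involutive)
open import Defs

open +-*-Solver using (solve; _:+_; _:*_; _:=_; con)

𝟙 : Bool → ℕ
𝟙 b = if b then 1 else 0

∑ : ∀ {n} → (Subset n → ℕ) → ℕ
∑ {zero}  F = F []
∑ {suc n} F = ∑ (λ S → F (inside ∷ S)) + ∑ (λ S → F (outside ∷ S))

∑-cong : ∀ {n} {F G : Subset n → ℕ} → (∀ S → F S ≡ G S) → ∑ F ≡ ∑ G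
∑-cong {zero}  F≗G = F≗G []
∑-cong {suc n} F≗G = cong₂ _+_ (∑-cong (λ S → F≗G (inside ∷ S))) (∑-cong (λ S → F≗G (outside ∷ S)))

∑-0 : ∀ {n} → ∑ {n} (λ _ → 0) ≡ 0
∑-0 {zero}  = refl
∑-0 {suc n} = cong₂ _+_ (∑-0 {n}) (∑-0 {n})

∑-+ : ∀ {n} (F G : Subset n → ℕ) → ∑ (λ S → F S + G S) ≡ ∑ F + ∑ G
∑-+ {zero}  F G = refl
∑-+ {suc n} F G = begin
  ∑ (λ S → F (inside ∷ S) + G (inside ∷ S)) + ∑ (λ S → F (outside ∷ S) + G (outside ∷ S))
    ≡⟨ cong₂ _+_ (∑-+ (λ S → F (inside ∷ S)) (λ S → G (inside ∷ S))) (∑-+ (λ S → F (outside ∷ S)) (λ S → G (outside ∷ S))) ⟩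
  (Fᵢ + Gᵢ) + (Fₒ + Gₒ)
    ≡⟨ solve 4 (λ a b c d → (a :+ b) :+ (c :+ d) := (a :+ c) :+ (b :+ d)) refl Fᵢ Gᵢ Fₒ Gₒ ⟩
  (Fᵢ + Fₒ) + (Gᵢ + Gₒ) ∎
  where
  open ≡-Reasoning
  Fᵢ = ∑ (λ S → F (inside ∷ S))
  Gᵢ = ∑ (λ S → G (inside ∷ S))
  Fₒ = ∑ (λ S → F (outside ∷ S))
  Gₒ = ∑ (λ S → G (outside ∷ S))

∑-*ˡ : ∀ {n} c (F : Subset n → ℕ) → ∑ (λ S → c * F S) ≡ c * ∑ F
∑-*ˡ {zero}  c F = refl
∑-*ˡ {suc n} c F =
  trans (cong₂ _+_ (∑-*ˡ c (λ S → F (inside ∷ S))) (∑-*ˡ c (λ S → F (outside ∷ S))))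
        (sym (*-distribˡ-+ c (∑ (λ S → F (inside ∷ S))) (∑ (λ S → F (outside ∷ S)))))

term≤∑ : ∀ {n} (F : Subset n → ℕ) S → F S ≤ ∑ F
term≤∑ {zero}  F []           = ≤-refl
term≤∑ {suc n} F (true ∷ S)  = ≤-trans (term≤∑ (λ S → F (inside ∷ S)) S) (m≤m+n _ (∑ (λ S → F (outside ∷ S))))
term≤∑ {suc n} F (false ∷ S) = ≤-trans (term≤∑ (λ S → F (outside ∷ S)) S) (m≤n+m _ (∑ (λ S → F (inside ∷ S))))

∑-pairUp : ∀ {n} (a : Fin n) (F : Subset n → ℕ) →
  ∑ F ≡ ∑ (λ T → if lookup T a then 0 else F T + F (T [ a ]≔ inside))
∑-pairUp {suc n} zero F = begin
  Fᵢ + Fₒ                                  ≡⟨ +-comm Fᵢ Fₒ ⟩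
  Fₒ + Fᵢ                                  ≡⟨ sym (∑-+ (λ S → F (outside ∷ S)) (λ S → F (inside ∷ S))) ⟩
  ∑ (λ S → F (outside ∷ S) + F (inside ∷ S)) ≡⟨ cong (_+ ∑ (λ S → F (outside ∷ S) + F (inside ∷ S))) (sym (∑-0 {n})) ⟩
  ∑ {n} (λ _ → 0) + ∑ (λ S → F (outside ∷ S) + F (inside ∷ S)) ∎
  where
  open ≡-Reasoning
  Fᵢ = ∑ (λ S → F (inside ∷ S))
  Fₒ = ∑ (λ S → F (outside ∷ S))
∑-pairUp {suc n} (suc a) F = cong₂ _+_ (∑-pairUp a (λ S → F (inside ∷ S))) (∑-pairUp a (λ S → F (outside ∷ S)))

weighted : ∀ {n} → (Subset n → Bool) → (Subset n → ℕ) → ℕ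
weighted Q ω = ∑ λ T → if Q T then ω T else 0

count≡weighted : ∀ {n} (P : Subset n → Bool) → count P ≡ weighted P (λ _ → 1)
count≡weighted {zero} P with P []
... | true  = refl
... | false = refl
count≡weighted {suc n} P = begin
  count P
    ≡⟨ cong List.length (filter-++ P? (List.map (inside ∷_) (allSubsets n)) (List.map (outside ∷_) (allSubsets n))) ⟩
  List.length (List.filter P? (List.map (inside ∷_) (allSubsets n)) List.++ List.filter P? (List.map (outside ∷_) (allSubsets n)))
    ≡⟨ length-++ (List.filter P? (List.map (inside ∷_) (allSubsets n))) ⟩
  List.length (List.filter P? (List.map (inside ∷_) (allSubsets n))) + List.length (List.filter P? (List.map (outside ∷_) (allSubsets n)))
    ≡⟨ cong₂ _+_ (count-map (inside ∷_) (allSubsets n)) (count-map (outside ∷_) (allSubsets n)) ⟩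
  count (λ S → P (inside ∷ S)) + count (λ S → P (outside ∷ S))
    ≡⟨ cong₂ _+_ (count≡weighted (λ S → P (inside ∷ S))) (count≡weighted (λ S → P (outside ∷ S))) ⟩
  weighted P (λ _ → 1) ∎
  where
  open ≡-Reasoning
  P? = λ S → T? (P S)
  count-map : ∀ (g : Subset n → Subset (suc n)) xs →
    List.length (List.filter (λ S → T? (P S)) (List.map g xs)) ≡ List.length (List.filter (λ S → T? (P (g S))) xs)
  count-map g List.[] = refl
  count-map g (S List.∷ xs) with P (g S)
  ... | true  = cong suc (count-map g xs)
  ... | false = count-map g xs

∃-or-∀ : ∀ {n} (P : Subset n → Bool) → (∃ λ S → P S ≡ true) ⊎ (∀ S → P S ≡ false)
∃-or-∀ {zero} P with P [] in eq
... | true  = inj₁ ([] , eq)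
... | false = inj₂ λ { [] → eq }
∃-or-∀ {suc n} P with ∃-or-∀ (λ S → P (inside ∷ S)) | ∃-or-∀ (λ S → P (outside ∷ S))
... | inj₁ (S , p) | _            = inj₁ (inside ∷ S , p)
... | inj₂ _       | inj₁ (S , p) = inj₁ (outside ∷ S , p)
... | inj₂ pᵢ      | inj₂ pₒ      = inj₂ λ { (true ∷ S) → pᵢ S ; (false ∷ S) → pₒ S }

-- Counting the sets on which a map is injective

-- `does` rather than `⌊_⌋`, so that `does (suc x ≟ suc y)` reduces to `does (x ≟ y)`.
fibreSize : ∀ {m n} → (Fin m → Fin n) → Fin n → ℕ
fibreSize {zero}  f t = 0
fibreSize {suc m} f t = 𝟙 (does (f zero ≟ t)) + fibreSize (f ∘ suc) t

∏∈ : ∀ {n} → Subset n → (Fin n → ℕ) → ℕ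
∏∈ []          h = 1
∏∈ (true ∷ T)  h = h zero * ∏∈ T (h ∘ suc)
∏∈ (false ∷ T) h = ∏∈ T (h ∘ suc)

∏∈-cong : ∀ {n} (T : Subset n) {g h : Fin n → ℕ} → (∀ t → lookup T t ≡ true → g t ≡ h t) → ∏∈ T g ≡ ∏∈ T h
∏∈-cong []          g≗h = refl
∏∈-cong (true ∷ T)  g≗h = cong₂ _*_ (g≗h zero refl) (∏∈-cong T (g≗h ∘ suc))
∏∈-cong (false ∷ T) g≗h = ∏∈-cong T (g≗h ∘ suc)

∏∈-* : ∀ {n} (T : Subset n) (g h : Fin n → ℕ) → ∏∈ T (λ t → g t * h t) ≡ ∏∈ T g * ∏∈ T h
∏∈-* []          g h = refl
∏∈-* (false ∷ T) g h = ∏∈-* T (g ∘ suc) (h ∘ suc)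
∏∈-* (true ∷ T)  g h = trans (cong (g zero * h zero *_) (∏∈-* T (g ∘ suc) (h ∘ suc)))
  (solve 4 (λ a b c d → (a :* b) :* (c :* d) := (a :* c) :* (b :* d)) refl (g zero) (h zero) (∏∈ T (g ∘ suc)) (∏∈ T (h ∘ suc)))

∏∈-const : ∀ {n} (T : Subset n) k → ∏∈ T (λ _ → k) ≡ k ^ ∣ T ∣ˢ
∏∈-const []          k = refl
∏∈-const (true ∷ T)  k = cong (k *_) (∏∈-const T k)
∏∈-const (false ∷ T) k = ∏∈-const T k

∏∈-insert : ∀ {n} (T : Subset n) (h : Fin n → ℕ) a → lookup T a ≡ false → ∏∈ (T [ a ]≔ inside) h ≡ h a * ∏∈ T h
∏∈-insert (false ∷ T) h zero    a∉T = refl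
∏∈-insert (false ∷ T) h (suc a) a∉T = ∏∈-insert T (h ∘ suc) a a∉T
∏∈-insert (true ∷ T)  h (suc a) a∉T = trans (cong (h zero *_) (∏∈-insert T (h ∘ suc) a a∉T))
  (solve 3 (λ x y z → x :* (y :* z) := y :* (x :* z)) refl (h zero) (h (suc a)) (∏∈ T (h ∘ suc)))

∑-∏∈-0 : ∀ {n} (P : Subset n → ℕ) → ∑ (λ T → P T * ∏∈ T (λ _ → 0)) ≡ P ∅
∑-∏∈-0 {zero}  P = *-identityʳ (P [])
∑-∏∈-0 {suc n} P = cong₂ _+_
  (trans (∑-cong (λ T → *-zeroʳ (P (inside ∷ T)))) (∑-0 {n}))
  (∑-∏∈-0 (λ T → P (outside ∷ T)))

vec-ext : ∀ {A : Set} {n} (xs ys : Vec A n) → (∀ e → lookup xs e ≡ lookup ys e) → xs ≡ ys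
vec-ext xs ys xs≗ys = trans (sym (tabulate∘lookup xs)) (trans (tabulate-cong xs≗ys) (tabulate∘lookup ys))

lookup-image-∷ : ∀ {m n} (f : Fin (suc m) → Fin n) x S e →
  lookup (image f (x ∷ S)) e ≡ (x ∧ ⌊ f zero ≟ e ⌋) ∨ lookup (image (f ∘ suc) S) e
lookup-image-∷ {m} f x S e = trans (lookup∘tabulate _ e) (cong ((x ∧ ⌊ f zero ≟ e ⌋) ∨_) (begin
  any q (List.tabulate suc)         ≡⟨ cong or (map-tabulate suc q) ⟩
  or (List.tabulate (q ∘ suc))      ≡⟨ cong or (map-tabulate id (q ∘ suc)) ⟨
  any (q ∘ suc) (List.allFin m)     ≡⟨ lookup∘tabulate _ e ⟨
  lookup (image (f ∘ suc) S) e ∎))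
  where
  open ≡-Reasoning
  q = λ y → mem y (x ∷ S) ∧ ⌊ f y ≟ e ⌋

image-[] : ∀ {n} (f : Fin 0 → Fin n) → image f [] ≡ ∅
image-[] f = vec-ext _ _ (λ e → trans (lookup∘tabulate _ e) (sym (lookup-replicate e outside)))

image-outside : ∀ {m n} (f : Fin (suc m) → Fin n) S → image f (outside ∷ S) ≡ image (f ∘ suc) S
image-outside f S = vec-ext _ _ (lookup-image-∷ f outside S)

image-inside : ∀ {m n} (f : Fin (suc m) → Fin n) S → image f (inside ∷ S) ≡ image (f ∘ suc) S [ f zero ]≔ inside
image-inside f S = vec-ext _ _ λ e → trans (lookup-image-∷ f inside S e) (lookup-insert e (f zero ≟ e))
  where
  V = image (f ∘ suc) S
  lookup-insert : ∀ e (d : Dec (f zero ≡ e)) → ⌊ d ⌋ ∨ lookup V e ≡ lookup (V [ f zero ]≔ inside) e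
  lookup-insert e (yes refl) = sym (lookup∘update (f zero) V inside)
  lookup-insert e (no f0≢e)  = sym (lookup∘update′ (f0≢e ∘ sym) V inside)

[]≔-idem : ∀ {n} (T : Subset n) a → lookup T a ≡ true → T [ a ]≔ inside ≡ T
[]≔-idem (true ∷ T) zero    a∈T = refl
[]≔-idem (x ∷ T)    (suc a) a∈T = cong (x ∷_) ([]≔-idem T a a∈T)

∣[]≔inside∣ : ∀ {n} (T : Subset n) a → lookup T a ≡ false → ∣ T [ a ]≔ inside ∣ˢ ≡ suc ∣ T ∣ˢ
∣[]≔inside∣ (false ∷ T) zero    a∉T = refl
∣[]≔inside∣ (true ∷ T)  (suc a) a∉T = cong suc (∣[]≔inside∣ T a a∉T)
∣[]≔inside∣ (false ∷ T) (suc a) a∉T = ∣[]≔inside∣ T a a∉T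

∣[]≔inside∣≤ : ∀ {n} (T : Subset n) a → ∣ T [ a ]≔ inside ∣ˢ ≤ suc ∣ T ∣ˢ
∣[]≔inside∣≤ T a with lookup T a in eq
... | true  = ≤-trans (≤-reflexive (cong ∣_∣ˢ ([]≔-idem T a eq))) (n≤1+n _)
... | false = ≤-reflexive (∣[]≔inside∣ T a eq)

∣image∣≤ : ∀ {m n} (f : Fin m → Fin n) S → ∣ image f S ∣ˢ ≤ ∣ S ∣ˢ
∣image∣≤ {zero}  {n} f [] = ≤-reflexive (trans (cong ∣_∣ˢ (image-[] f)) (∣⊥∣≡0 n))
∣image∣≤ {suc m} f (false ∷ S) = subst (λ V → ∣ V ∣ˢ ≤ ∣ S ∣ˢ) (sym (image-outside f S)) (∣image∣≤ (f ∘ suc) S)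
∣image∣≤ {suc m} f (true ∷ S)  = subst (λ V → ∣ V ∣ˢ ≤ suc ∣ S ∣ˢ) (sym (image-inside f S))
  (≤-trans (∣[]≔inside∣≤ (image (f ∘ suc) S) (f zero)) (s≤s (∣image∣≤ (f ∘ suc) S)))

≤⇒suc≡ᵇ≡false : ∀ {s v} → v ≤ s → (suc s ≡ᵇ v) ≡ false
≤⇒suc≡ᵇ≡false z≤n       = refl
≤⇒suc≡ᵇ≡false (s≤s v≤s) = ≤⇒suc≡ᵇ≡false v≤s

injectiveOn : ∀ {m n} → (Fin m → Fin n) → Subset m → Bool
injectiveOn f S = ∣ S ∣ˢ ≡ᵇ ∣ image f S ∣ˢ

withAdded : ∀ {n} → Fin n → (Subset n → ℕ) → Subset n → ℕ
withAdded a P V = if lookup V a then 0 else P (V [ a ]≔ inside)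

injectiveOn-outside : ∀ {m n} (f : Fin (suc m) → Fin n) (P : Subset n → ℕ) S →
  (if injectiveOn f (outside ∷ S) then P (image f (outside ∷ S)) else 0) ≡
  (if injectiveOn (f ∘ suc) S then P (image (f ∘ suc) S) else 0)
injectiveOn-outside f P S rewrite image-outside f S = refl

injectiveOn-inside : ∀ {m n} (f : Fin (suc m) → Fin n) (P : Subset n → ℕ) S →
  (if injectiveOn f (inside ∷ S) then P (image f (inside ∷ S)) else 0) ≡
  (if injectiveOn (f ∘ suc) S then withAdded (f zero) P (image (f ∘ suc) S) else 0)
injectiveOn-inside f P S rewrite image-inside f S = insert (image (f ∘ suc) S) (∣image∣≤ (f ∘ suc) S)
  where
  a = f zero
  insert : ∀ V → ∣ V ∣ˢ ≤ ∣ S ∣ˢ →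
    (if suc ∣ S ∣ˢ ≡ᵇ ∣ V [ a ]≔ inside ∣ˢ then P (V [ a ]≔ inside) else 0) ≡
    (if ∣ S ∣ˢ ≡ᵇ ∣ V ∣ˢ then withAdded a P V else 0)
  insert V ∣V∣≤∣S∣ with lookup V a in a∈V
  ... | false rewrite ∣[]≔inside∣ V a a∈V = refl
  ... | true rewrite []≔-idem V a a∈V | ≤⇒suc≡ᵇ≡false ∣V∣≤∣S∣ with ∣ S ∣ˢ ≡ᵇ ∣ V ∣ˢ
  ... | true  = refl
  ... | false = refl

true≢false : true ≢ false
true≢false ()

𝟙≟-refl : ∀ {n} (a : Fin n) → 𝟙 (does (a ≟ a)) ≡ 1
𝟙≟-refl a with a ≟ a
... | yes _   = refl
... | no a≢a = ⊥-elim (a≢a refl)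

𝟙≟-≢ : ∀ {n} (a t : Fin n) → ¬ a ≡ t → 𝟙 (does (a ≟ t)) ≡ 0
𝟙≟-≢ a t a≢t with a ≟ t
... | yes a≡t = ⊥-elim (a≢t a≡t)
... | no _    = refl

-- Pair each T ∌ f 0 with T ∪ {f 0}: the fibres of f and f ∘ suc differ only over f 0.
∑-withAdded : ∀ {m n} (f : Fin (suc m) → Fin n) (P : Subset n → ℕ) →
  ∑ (λ T → withAdded (f zero) P T * ∏∈ T (fibreSize (f ∘ suc))) + ∑ (λ T → P T * ∏∈ T (fibreSize (f ∘ suc)))
  ≡ ∑ (λ T → P T * ∏∈ T (fibreSize f))
∑-withAdded {m} {n} f P = begin
  ∑ (λ T → withAdded a P T * w′ T) + ∑ (λ T → P T * w′ T)
    ≡⟨ cong₂ _+_ (∑-pairUp a (λ T → withAdded a P T * w′ T)) (∑-pairUp a (λ T → P T * w′ T)) ⟩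
  ∑ (paired (λ T → withAdded a P T * w′ T)) + ∑ (paired (λ T → P T * w′ T))
    ≡⟨ ∑-+ (paired (λ T → withAdded a P T * w′ T)) (paired (λ T → P T * w′ T)) ⟨
  ∑ (λ T → paired (λ T → withAdded a P T * w′ T) T + paired (λ T → P T * w′ T) T)
    ≡⟨ ∑-cong pairwise ⟩
  ∑ (paired (λ T → P T * w T))
    ≡⟨ ∑-pairUp a (λ T → P T * w T) ⟨
  ∑ (λ T → P T * w T) ∎
  where
  open ≡-Reasoning
  a = f zero
  w w′ : Subset n → ℕ
  w  T = ∏∈ T (fibreSize f)
  w′ T = ∏∈ T (fibreSize (f ∘ suc))
  paired : (Subset n → ℕ) → Subset n → ℕ
  paired F T = if lookup T a then 0 else F T + F (T [ a ]≔ inside)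

  pairwise : ∀ T → paired (λ T → withAdded a P T * w′ T) T + paired (λ T → P T * w′ T) T ≡ paired (λ T → P T * w T) T
  pairwise T with lookup T a in a∉T
  ... | true  = refl
  ... | false = begin
    (P T⁺ * w′ T + withAdded a P T⁺ * w′ T⁺) + (P T * w′ T + P T⁺ * w′ T⁺)
      ≡⟨ cong₂ (λ x y → (P T⁺ * w′ T + x * y) + (P T * w′ T + P T⁺ * y)) added-twice w′T⁺ ⟩
    (P T⁺ * w′ T + 0 * (c * w′ T)) + (P T * w′ T + P T⁺ * (c * w′ T))
      ≡⟨ solve 4 (λ p⁺ p x c → (p⁺ :* x :+ con 0 :* (c :* x)) :+ (p :* x :+ p⁺ :* (c :* x)) := p :* x :+ p⁺ :* ((con 1 :+ c) :* x)) refl (P T⁺) (P T) (w′ T) c ⟩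
    P T * w′ T + P T⁺ * ((1 + c) * w′ T)
      ≡⟨ cong₂ (λ x y → P T * x + P T⁺ * y) (sym wT) (sym wT⁺) ⟩
    P T * w T + P T⁺ * w T⁺ ∎
    where
    T⁺ = T [ a ]≔ inside
    c = fibreSize (f ∘ suc) a
    added-twice : withAdded a P T⁺ ≡ 0
    added-twice = cong (λ b → if b then 0 else P (T⁺ [ a ]≔ inside)) (lookup∘update a T inside)
    w′T⁺ : w′ T⁺ ≡ c * w′ T
    w′T⁺ = ∏∈-insert T (fibreSize (f ∘ suc)) a a∉T
    wT : w T ≡ w′ T
    wT = ∏∈-cong T λ t t∈T → cong (_+ fibreSize (f ∘ suc) t) (𝟙≟-≢ a t λ { refl → true≢false (trans (sym t∈T) a∉T) })
    wT⁺ : w T⁺ ≡ (1 + c) * w′ T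
    wT⁺ = trans (∏∈-insert T (fibreSize f) a a∉T) (cong₂ _*_ (cong (_+ c) (𝟙≟-refl a)) wT)

-- A set on which f is injective amounts to its image T together with a choice of one
-- preimage of each t ∈ T.
∑-injectiveOn : ∀ {m n} (f : Fin m → Fin n) (P : Subset n → ℕ) →
  ∑ (λ S → if injectiveOn f S then P (image f S) else 0) ≡ ∑ (λ T → P T * ∏∈ T (fibreSize f))
∑-injectiveOn {zero} {n} f P rewrite image-[] f | ∣⊥∣≡0 n = sym (∑-∏∈-0 P)
∑-injectiveOn {suc m} f P = trans
  (cong₂ _+_
    (trans (∑-cong (injectiveOn-inside f P)) (∑-injectiveOn (f ∘ suc) (withAdded (f zero) P)))
    (trans (∑-cong (injectiveOn-outside f P)) (∑-injectiveOn (f ∘ suc) P)))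
  (∑-withAdded f P)

fibreSize-cong : ∀ {m n} {g h : Fin m → Fin n} t → (∀ x → g x ≡ h x) → fibreSize g t ≡ fibreSize h t
fibreSize-cong {zero}  t g≗h = refl
fibreSize-cong {suc m} t g≗h = cong₂ _+_ (cong (λ y → 𝟙 (does (y ≟ t))) (g≗h zero)) (fibreSize-cong t (g≗h ∘ suc))

fibreSize-↑ : ∀ a {b n} (g : Fin (a + b) → Fin n) t →
  fibreSize g t ≡ fibreSize (λ x → g (x ↑ˡ b)) t + fibreSize (λ y → g (a ↑ʳ y)) t
fibreSize-↑ zero        g t = refl
fibreSize-↑ (suc a) {b} g t = trans (cong (𝟙 (does (g zero ≟ t)) +_) (fibreSize-↑ a (g ∘ suc) t))
  (sym (+-assoc (𝟙 (does (g zero ≟ t))) (fibreSize (λ x → g (suc (x ↑ˡ b))) t) (fibreSize (λ y → g (suc a ↑ʳ y)) t)))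

fibreSize-suc-zero : ∀ {m n} (g : Fin m → Fin n) → fibreSize (λ x → suc (g x)) zero ≡ 0
fibreSize-suc-zero {zero}  g = refl
fibreSize-suc-zero {suc m} g = fibreSize-suc-zero (g ∘ suc)

fibreSize-suc-suc : ∀ {m n} (g : Fin m → Fin n) t → fibreSize (λ x → suc (g x)) (suc t) ≡ fibreSize g t
fibreSize-suc-suc {zero}  g t = refl
fibreSize-suc-suc {suc m} g t = cong (𝟙 (does (g zero ≟ t)) +_) (fibreSize-suc-suc (g ∘ suc) t)

fibreSize-id : ∀ {n} (t : Fin n) → fibreSize id t ≡ 1
fibreSize-id {suc n} zero    = cong suc (fibreSize-suc-zero {n} id)
fibreSize-id {suc n} (suc t) = trans (fibreSize-suc-suc {n} id t) (fibreSize-id t)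

fibreSize-remQuot : ∀ q {l n} (h : Fin l → Fin n) t →
  fibreSize (λ z → h (proj₂ (remQuot {q} l z))) t ≡ q * fibreSize h t
fibreSize-remQuot zero    h t = refl
fibreSize-remQuot (suc q) {l} h t = begin
  fibreSize (λ z → h (proj₂ (remQuot {suc q} l z))) t
    ≡⟨ fibreSize-↑ l (λ z → h (proj₂ (remQuot {suc q} l z))) t ⟩
  fibreSize (λ x → h (proj₂ (remQuot {suc q} l (x ↑ˡ (q * l))))) t + fibreSize (λ y → h (proj₂ (remQuot {suc q} l (l ↑ʳ y)))) t
    ≡⟨ cong₂ _+_ (fibreSize-cong t (λ x → cong h (remQuot-↑ˡ x))) (fibreSize-cong t (λ y → cong h (remQuot-↑ʳ y))) ⟩
  fibreSize h t + fibreSize (λ y → h (proj₂ (remQuot {q} l y))) t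
    ≡⟨ cong (fibreSize h t +_) (fibreSize-remQuot q h t) ⟩
  fibreSize h t + q * fibreSize h t ∎
  where
  open ≡-Reasoning
  remQuot-↑ˡ : ∀ x → proj₂ (remQuot {suc q} l (x ↑ˡ (q * l))) ≡ x
  remQuot-↑ˡ x rewrite splitAt-↑ˡ l x (q * l) = refl
  remQuot-↑ʳ : ∀ y → proj₂ (remQuot {suc q} l (l ↑ʳ y)) ≡ proj₂ (remQuot {q} l y)
  remQuot-↑ʳ y rewrite splitAt-↑ʳ l (q * l) y = refl

fibreSize-tabulate : ∀ {m n} (g : Fin m → Fin n) t → fibreSize (List.lookup (List.tabulate g)) t ≡ fibreSize g t
fibreSize-tabulate {zero}  g t = refl
fibreSize-tabulate {suc m} g t = cong (𝟙 (does (g zero ≟ t)) +_) (fibreSize-tabulate (g ∘ suc) t)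

fibreSize-filter : ∀ {n ℓ} {P : Pred (Fin n) ℓ} (P? : Decidable P) (xs : List.List (Fin n)) t →
  fibreSize (List.lookup (List.filter P? xs)) t ≡ (if does (P? t) then fibreSize (List.lookup xs) t else 0)
fibreSize-filter P? List.[] t with does (P? t)
... | true  = refl
... | false = refl
fibreSize-filter P? (x List.∷ xs) t with does (P? x) in Px | does (P? t) in Pt | fibreSize-filter P? xs t
... | true  | true  | ih = cong (𝟙 (does (x ≟ t)) +_) ih
... | false | false | ih = ih
... | true  | false | ih = cong₂ _+_ (𝟙≟-≢ x t λ { refl → true≢false (trans (sym Px) Pt) }) ih
... | false | true  | ih = trans ih (cong (_+ fibreSize (List.lookup xs) t) (sym (𝟙≟-≢ x t λ { refl → true≢false (trans (sym Pt) Px) })))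

inPair : ∀ {n} → Fin n → Fin n → Fin n → Bool
inPair i j t = does (t ≟ i) ∨ does (t ≟ j)

fibreSize-others : ∀ {n} (i j t : Fin n) → fibreSize (List.lookup (others i j)) t ≡ (if inPair i j t then 0 else 1)
fibreSize-others {n} i j t = trans (fibreSize-filter _ (List.allFin n) t) (select (t ≟ i) (t ≟ j))
  where
  select : (t≟i : Dec (t ≡ i)) (t≟j : Dec (t ≡ j)) →
    (if does (¬? t≟i ×-dec ¬? t≟j) then fibreSize (List.lookup (List.allFin n)) t else 0) ≡
    (if does t≟i ∨ does t≟j then 0 else 1)
  select (yes _) _       = refl
  select (no _)  (yes _) = refl
  select (no _)  (no _)  = trans (fibreSize-tabulate id t) (fibreSize-id t)

proj-↑ˡ : ∀ k {n} (i j : Fin n) x → proj k i j (x ↑ˡ ((k ∸ 1) * L i j)) ≡ x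
proj-↑ˡ k {n} i j x rewrite splitAt-↑ˡ n x ((k ∸ 1) * L i j) = refl

proj-↑ʳ : ∀ k {n} (i j : Fin n) y →
  proj k i j (n ↑ʳ y) ≡ List.lookup (others i j) (proj₂ (remQuot {k ∸ 1} (L i j) y))
proj-↑ʳ k {n} i j y rewrite splitAt-↑ʳ n ((k ∸ 1) * L i j) y = refl

fibreSize-proj : ∀ k {n} (i j t : Fin n) → fibreSize (proj k i j) t ≡ 1 + (k ∸ 1) * (if inPair i j t then 0 else 1)
fibreSize-proj k {n} i j t = begin
  fibreSize (proj k i j) t
    ≡⟨ fibreSize-↑ n (proj k i j) t ⟩
  fibreSize (λ x → proj k i j (x ↑ˡ ((k ∸ 1) * L i j))) t + fibreSize (λ y → proj k i j (n ↑ʳ y)) t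
    ≡⟨ cong₂ _+_ (fibreSize-cong t (proj-↑ˡ k i j)) (fibreSize-cong t (proj-↑ʳ k i j)) ⟩
  fibreSize id t + fibreSize (λ y → List.lookup (others i j) (proj₂ (remQuot {k ∸ 1} (L i j) y))) t
    ≡⟨ cong₂ _+_ (fibreSize-id t) (fibreSize-remQuot (k ∸ 1) (List.lookup (others i j)) t) ⟩
  1 + (k ∸ 1) * fibreSize (List.lookup (others i j)) t
    ≡⟨ cong (λ m → 1 + (k ∸ 1) * m) (fibreSize-others i j t) ⟩
  1 + (k ∸ 1) * (if inPair i j t then 0 else 1) ∎
  where open ≡-Reasoning

fibreSize-proj-scaled : ∀ k {n} (i j : Fin n) → 1 ≤ k → i ≢ j → ∀ t →
  fibreSize (proj k i j) t * (k ^ 𝟙 (does (t ≟ i)) * k ^ 𝟙 (does (t ≟ j))) ≡ k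
fibreSize-proj-scaled (suc k) i j _ i≢j t rewrite fibreSize-proj (suc k) i j t with t ≟ i | t ≟ j
... | yes refl | yes refl = ⊥-elim (i≢j refl)
... | yes refl | no _     = solve 1 (λ k → (con 1 :+ k :* con 0) :* (((con 1 :+ k) :* con 1) :* con 1) := con 1 :+ k) refl k
... | no _     | yes refl = solve 1 (λ k → (con 1 :+ k :* con 0) :* (con 1 :* ((con 1 :+ k) :* con 1)) := con 1 :+ k) refl k
... | no _     | no _     = solve 1 (λ k → (con 1 :+ k :* con 1) :* (con 1 :* con 1) := con 1 :+ k) refl k

∏∈-^𝟙≟ : ∀ {n} (T : Subset n) k a → ∏∈ T (λ t → k ^ 𝟙 (does (t ≟ a))) ≡ k ^ 𝟙 (lookup T a)
∏∈-^𝟙≟ (true ∷ T)  k zero    = trans (cong (k * 1 *_) (trans (∏∈-const T 1) (^-zeroˡ ∣ T ∣ˢ))) (*-identityʳ (k * 1))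
∏∈-^𝟙≟ (false ∷ T) k zero    = trans (∏∈-const T 1) (^-zeroˡ ∣ T ∣ˢ)
∏∈-^𝟙≟ (true ∷ T)  k (suc a) = trans (+-identityʳ _) (∏∈-^𝟙≟ T k a)
∏∈-^𝟙≟ (false ∷ T) k (suc a) = ∏∈-^𝟙≟ T k a

∏∈-fibreSize-proj : ∀ k {n} (i j : Fin n) → 1 ≤ k → i ≢ j → ∀ T →
  ∏∈ T (fibreSize (proj k i j)) * (k ^ 𝟙 (lookup T i) * k ^ 𝟙 (lookup T j)) ≡ k ^ ∣ T ∣ˢ
∏∈-fibreSize-proj k i j 1≤k i≢j T = begin
  ∏∈ T fib * (k ^ 𝟙 (lookup T i) * k ^ 𝟙 (lookup T j))
    ≡⟨ cong (∏∈ T fib *_) (cong₂ _*_ (∏∈-^𝟙≟ T k i) (∏∈-^𝟙≟ T k j)) ⟨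
  ∏∈ T fib * (∏∈ T (kAt i) * ∏∈ T (kAt j))
    ≡⟨ cong (∏∈ T fib *_) (∏∈-* T (kAt i) (kAt j)) ⟨
  ∏∈ T fib * ∏∈ T (λ t → kAt i t * kAt j t)
    ≡⟨ ∏∈-* T fib (λ t → kAt i t * kAt j t) ⟨
  ∏∈ T (λ t → fib t * (kAt i t * kAt j t))
    ≡⟨ ∏∈-cong T (λ t _ → fibreSize-proj-scaled k i j 1≤k i≢j t) ⟩
  ∏∈ T (λ _ → k)
    ≡⟨ ∏∈-const T k ⟩
  k ^ ∣ T ∣ˢ ∎
  where
  open ≡-Reasoning
  fib = fibreSize (proj k i j)
  kAt : _ → _ → ℕ
  kAt a t = k ^ 𝟙 (does (t ≟ a))

lookup-image-∉ : ∀ {m n} (f : Fin m → Fin n) S e → (∀ x → f x ≢ e) → lookup (image f S) e ≡ false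
lookup-image-∉ {zero}  f [] e _ = trans (cong (λ V → lookup V e) (image-[] f)) (lookup-replicate e outside)
lookup-image-∉ {suc m} f (x ∷ S) e f≢e
  rewrite lookup-image-∷ f x S e | lookup-image-∉ (f ∘ suc) S e (f≢e ∘ suc) with f zero ≟ e
... | yes f0≡e = ⊥-elim (f≢e zero f0≡e)
... | no _     = trans (∨-identityʳ (x ∧ false)) (∧-zeroʳ x)

lookup-image-fibre : ∀ {m n} (f : Fin m → Fin n) S x₀ → (∀ x → f x ≡ f x₀ → x ≡ x₀) →
  lookup (image f S) (f x₀) ≡ lookup S x₀
lookup-image-fibre f (x ∷ S) zero fibre
  rewrite lookup-image-∷ f x S (f zero) | lookup-image-∉ (f ∘ suc) S (f zero) (λ y e → case fibre (suc y) e of λ ())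
  with f zero ≟ f zero
... | yes _     = trans (∨-identityʳ (x ∧ true)) (∧-identityʳ x)
... | no f0≢f0 = ⊥-elim (f0≢f0 refl)
lookup-image-fibre f (x ∷ S) (suc y) fibre
  rewrite lookup-image-∷ f x S (f (suc y)) | lookup-image-fibre (f ∘ suc) S y (λ z e → suc-injective (fibre (suc z) e))
  with f zero ≟ f (suc y)
... | yes e     = case fibre zero e of λ ()
... | no _      = cong (_∨ lookup S y) (∧-zeroʳ x)

others-avoid : ∀ {n} (i j : Fin n) l → List.lookup (others i j) l ≢ i × List.lookup (others i j) l ≢ j
others-avoid {n} i j l = proj₂ (∈-filter⁻ (λ e → ¬? (e ≟ i) ×-dec ¬? (e ≟ j)) {xs = List.allFin n} (∈-lookup l))

proj-fibre : ∀ k {n} (i j e : Fin n) → e ≡ i ⊎ e ≡ j → ∀ x → proj k i j x ≡ e → x ≡ emb k i j e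
proj-fibre k {n} i j e e∈ij x projx≡e = trans (sym (join-splitAt n c x)) (onSplit (splitAt n x) projx≡e)
  where
  c = (k ∸ 1) * L i j
  onSplit : ∀ s → [ id , (λ z → List.lookup (others i j) (proj₂ (remQuot {k ∸ 1} (L i j) z))) ] s ≡ e →
    join n c s ≡ e ↑ˡ c
  onSplit (inj₁ y) refl = refl
  onSplit (inj₂ z) l≡e = ⊥-elim ([ (λ e≡i → proj₁ (others-avoid i j _) (trans l≡e e≡i))
                                  , (λ e≡j → proj₂ (others-avoid i j _) (trans l≡e e≡j)) ] e∈ij)

mem-emb : ∀ k {n} (i j e : Fin n) → e ≡ i ⊎ e ≡ j → ∀ S → mem (emb k i j e) S ≡ mem e (image (proj k i j) S)
mem-emb k i j e e∈ij S = sym (trans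
  (cong (lookup (image (proj k i j) S)) (sym (proj-↑ˡ k i j e)))
  (lookup-image-fibre (proj k i j) S (emb k i j e) λ x p → proj-fibre k i j e e∈ij x (trans p (proj-↑ˡ k i j e))))

-- The four classes of bases

_==_ : Bool → Bool → Bool
x == true  = x
x == false = not x

inClass : ∀ {n} → BasisFamily n → Fin n → Fin n → Bool → Bool → Subset n → Bool
inClass 𝓑 i j a c T = 𝓑 T ∧ (lookup T i == a ∧ lookup T j == c)

classWeight : ∀ {n} → BasisFamily n → Fin n → Fin n → (Subset n → ℕ) → Bool → Bool → ℕ
classWeight 𝓑 i j ω a c = weighted (inClass 𝓑 i j a c) ω

module _ {n} (𝓑 : BasisFamily n) (i j : Fin n) (ω : Subset n → ℕ) where

  private
    X : Bool → Bool → ℕ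
    X = classWeight 𝓑 i j ω

    ifω : Bool → Subset n → ℕ
    ifω b T = if b then ω T else 0

    C : Bool → Bool → Subset n → ℕ
    C a c T = ifω (inClass 𝓑 i j a c T) T

    ∑-+-+ : ∀ (F G H K : Subset n → ℕ) → ∑ (λ T → (F T + G T) + (H T + K T)) ≡ (∑ F + ∑ G) + (∑ H + ∑ K)
    ∑-+-+ F G H K = trans (∑-+ (λ T → F T + G T) (λ T → H T + K T)) (cong₂ _+_ (∑-+ F G) (∑-+ H K))

  weighted-bases : weighted 𝓑 ω ≡ (X true true + X true false) + (X false true + X false false)
  weighted-bases = trans (∑-cong split) (∑-+-+ (C true true) (C true false) (C false true) (C false false))
    where
    split : ∀ T → ifω (𝓑 T) T ≡ (C true true T + C true false T) + (C false true T + C false false T)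
    split T with 𝓑 T | lookup T i | lookup T j
    ... | false | _     | _     = refl
    ... | true  | true  | true  = sym (trans (+-identityʳ _) (+-identityʳ (ω T)))
    ... | true  | true  | false = sym (+-identityʳ (ω T))
    ... | true  | false | true  = sym (+-identityʳ (ω T))
    ... | true  | false | false = refl

  weighted-bases-∋i : weighted (λ T → 𝓑 T ∧ lookup T i) ω ≡ X true true + X true false
  weighted-bases-∋i = trans (∑-cong split) (∑-+ (C true true) (C true false))
    where
    split : ∀ T → ifω (𝓑 T ∧ lookup T i) T ≡ C true true T + C true false T
    split T with 𝓑 T | lookup T i | lookup T j
    ... | false | _     | _     = refl
    ... | true  | false | _     = refl
    ... | true  | true  | true  = sym (+-identityʳ (ω T))
    ... | true  | true  | false = refl

  weighted-bases-∋j : weighted (λ T → 𝓑 T ∧ lookup T j) ω ≡ X true true + X false true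
  weighted-bases-∋j = trans (∑-cong split) (∑-+ (C true true) (C false true))
    where
    split : ∀ T → ifω (𝓑 T ∧ lookup T j) T ≡ C true true T + C false true T
    split T with 𝓑 T | lookup T i | lookup T j
    ... | false | _     | _     = refl
    ... | true  | true  | false = refl
    ... | true  | false | false = refl
    ... | true  | true  | true  = sym (+-identityʳ (ω T))
    ... | true  | false | true  = refl

  weighted-bases-∋ji : weighted (λ T → 𝓑 T ∧ lookup T j ∧ lookup T i) ω ≡ X true true
  weighted-bases-∋ji = ∑-cong λ T → cong (λ b → ifω (𝓑 T ∧ b) T) (∧-comm (lookup T j) (lookup T i))

count-injectiveOn : ∀ {m n} (f : Fin m → Fin n) (P : Subset n → Bool) →
  count (λ S → injectiveOn f S ∧ P (image f S)) ≡ weighted P (λ T → ∏∈ T (fibreSize f))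
count-injectiveOn f P = begin
  count (λ S → injectiveOn f S ∧ P (image f S))
    ≡⟨ count≡weighted (λ S → injectiveOn f S ∧ P (image f S)) ⟩
  ∑ (λ S → 𝟙 (injectiveOn f S ∧ P (image f S)))
    ≡⟨ ∑-cong (λ S → 𝟙-∧ (injectiveOn f S) (P (image f S))) ⟩
  ∑ (λ S → if injectiveOn f S then 𝟙 (P (image f S)) else 0)
    ≡⟨ ∑-injectiveOn f (λ T → 𝟙 (P T)) ⟩
  ∑ (λ T → 𝟙 (P T) * ∏∈ T (fibreSize f))
    ≡⟨ ∑-cong (λ T → 𝟙-* (P T) (∏∈ T (fibreSize f))) ⟩
  weighted P (λ T → ∏∈ T (fibreSize f)) ∎
  where
  open ≡-Reasoning
  𝟙-∧ : ∀ a b → 𝟙 (a ∧ b) ≡ (if a then 𝟙 b else 0)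
  𝟙-∧ true  b = refl
  𝟙-∧ false b = refl
  𝟙-* : ∀ b w → 𝟙 b * w ≡ (if b then w else 0)
  𝟙-* true  w = +-identityʳ w
  𝟙-* false w = refl

module _ {n} (𝓑 : BasisFamily n) (i j : Fin n) (k : ℕ) where

  weightMk : Subset n → ℕ
  weightMk T = ∏∈ T (fibreSize (proj k i j))

  count-Mk-bases : count (Mk-bases 𝓑 i j k) ≡ weighted 𝓑 weightMk
  count-Mk-bases = count-injectiveOn (proj k i j) 𝓑

  count-Mk-bases-∧ : (Qₖ : Subset (GroundSize k i j) → Bool) (Q : Subset n → Bool) →
    (∀ S → Qₖ S ≡ Q (image (proj k i j) S)) →
    count (λ S → Mk-bases 𝓑 i j k S ∧ Qₖ S) ≡ weighted (λ T → 𝓑 T ∧ Q T) weightMk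
  count-Mk-bases-∧ Qₖ Q Qₖ≗Q = trans
    (trans (count≡weighted (λ S → Mk-bases 𝓑 i j k S ∧ Qₖ S)) (trans (∑-cong reassoc)
      (sym (count≡weighted (λ S → injectiveOn (proj k i j) S ∧ (𝓑 (image (proj k i j) S) ∧ Q (image (proj k i j) S)))))))
    (count-injectiveOn (proj k i j) (λ T → 𝓑 T ∧ Q T))
    where
    reassoc : ∀ S → 𝟙 (Mk-bases 𝓑 i j k S ∧ Qₖ S) ≡ 𝟙 (injectiveOn (proj k i j) S ∧ (𝓑 (image (proj k i j) S) ∧ Q (image (proj k i j) S)))
    reassoc S rewrite Qₖ≗Q S = cong 𝟙 (∧-assoc (injectiveOn (proj k i j) S) _ _)

  classWeight-Mk : ∀ r → HasRank 𝓑 r → 1 ≤ k → i ≢ j → ∀ a c →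
    classWeight 𝓑 i j weightMk a c * (k ^ 𝟙 a * k ^ 𝟙 c) ≡ k ^ r * classWeight 𝓑 i j (λ _ → 1) a c
  classWeight-Mk r rank 1≤k i≢j a c = begin
    classWeight 𝓑 i j weightMk a c * s                         ≡⟨ *-comm _ s ⟩
    s * classWeight 𝓑 i j weightMk a c                         ≡⟨ ∑-*ˡ s (λ T → if inClass 𝓑 i j a c T then weightMk T else 0) ⟨
    ∑ (λ T → s * (if inClass 𝓑 i j a c T then weightMk T else 0)) ≡⟨ ∑-cong scaled ⟩
    ∑ (λ T → k ^ r * (if inClass 𝓑 i j a c T then 1 else 0))     ≡⟨ ∑-*ˡ (k ^ r) (λ T → if inClass 𝓑 i j a c T then 1 else 0) ⟩
    k ^ r * classWeight 𝓑 i j (λ _ → 1) a c ∎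
    where
    open ≡-Reasoning
    s = k ^ 𝟙 a * k ^ 𝟙 c
    agree : ∀ x a → x == a ≡ true → x ≡ a
    agree true  true  _ = refl
    agree false false _ = refl
    scaled : ∀ T → s * (if inClass 𝓑 i j a c T then weightMk T else 0) ≡ k ^ r * (if inClass 𝓑 i j a c T then 1 else 0)
    scaled T with 𝓑 T in T∈𝓑 | lookup T i == a in i∈T | lookup T j == c in j∈T
    ... | false | _     | _     = trans (*-zeroʳ s) (sym (*-zeroʳ (k ^ r)))
    ... | true  | false | _     = trans (*-zeroʳ s) (sym (*-zeroʳ (k ^ r)))
    ... | true  | true  | false = trans (*-zeroʳ s) (sym (*-zeroʳ (k ^ r)))
    ... | true  | true  | true  = begin
      s * weightMk T
        ≡⟨ *-comm s (weightMk T) ⟩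
      weightMk T * (k ^ 𝟙 a * k ^ 𝟙 c)
        ≡⟨ cong₂ (λ x y → weightMk T * (k ^ 𝟙 x * k ^ 𝟙 y)) (agree _ a i∈T) (agree _ c j∈T) ⟨
      weightMk T * (k ^ 𝟙 (lookup T i) * k ^ 𝟙 (lookup T j))
        ≡⟨ ∏∈-fibreSize-proj k i j 1≤k i≢j T ⟩
      k ^ ∣ T ∣ˢ
        ≡⟨ cong (k ^_) (rank T T∈𝓑) ⟩
      k ^ r
        ≡⟨ *-identityʳ (k ^ r) ⟨
      k ^ r * 1 ∎

term≤weighted : ∀ {n} (Q : Subset n → Bool) (ω : Subset n → ℕ) S → Q S ≡ true → ω S ≤ weighted Q ω
term≤weighted Q ω S QS = subst (λ b → (if b then ω S else 0) ≤ weighted Q ω) QS (term≤∑ (λ T → if Q T then ω T else 0) S)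

∉⇒lookup≡false : ∀ {n} {x : Fin n} {B} → x ∉ B → lookup B x ≡ false
∉⇒lookup≡false {x = x} {B} x∉B with lookup B x in eq
... | true  = ⊥-elim (x∉B (lookup⇒[]= x B eq))
... | false = refl

x∈q⇒x∉p─q : ∀ {n} (p q : Subset n) {x} → x ∈ q → x ∉ p ─ q
x∈q⇒x∉p─q (_ ∷ p) (inside ∷ q) here ()
x∈q⇒x∉p─q (_ ∷ p) (_ ∷ q) (there x∈q) (there x∈p─q) = x∈q⇒x∉p─q p q x∈q x∈p─q

lookup≡false⇒∉ : ∀ {n} {x : Fin n} {B} → lookup B x ≡ false → x ∉ B
lookup≡false⇒∉ B[x]≡false x∈B = true≢false (trans (sym ([]=⇒lookup x∈B)) B[x]≡false)

not≡⇒≡not : ∀ {a b} → not a ≡ b → a ≡ not b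
not≡⇒≡not {true}  refl = refl
not≡⇒≡not {false} refl = refl

module _ {n} {𝓑 : BasisFamily n} (M : IsMatroid 𝓑) where
  open IsMatroid M

  basis-∌ : ∀ {j} → ¬ IsColoop 𝓑 j → ∃ λ B → 𝓑 B ≡ true × j ∉ B
  basis-∌ {j} ¬coloop with ∃-or-∀ (λ B → 𝓑 B ∧ not (lookup B j))
  ... | inj₁ (B , B∌j) = B , ∧-conicalˡ _ _ B∌j , lookup≡false⇒∉ (not≡⇒≡not (∧-conicalʳ (𝓑 B) _ B∌j))
  ... | inj₂ none = ⊥-elim (¬coloop λ B B∈𝓑 →
    lookup⇒[]= j B (not≡⇒≡not (subst (λ b → b ∧ not (lookup B j) ≡ false) B∈𝓑 (none B))))

  basis-∋∋ : ∀ {i j} → i ≢ j → ¬ IsLoop 𝓑 i → ¬ IsLoop 𝓑 j → ¬ Parallel 𝓑 i j →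
    ∃ λ B → 𝓑 B ≡ true × i ∈ B × j ∈ B
  basis-∋∋ {i} {j} i≢j ¬loopᵢ ¬loopⱼ ¬parallel with ∃-or-∀ (λ B → 𝓑 B ∧ (lookup B i ∧ lookup B j))
  ... | inj₁ (B , B∋ij) = B , ∧-conicalˡ _ _ B∋ij ,
    lookup⇒[]= i B (∧-conicalˡ _ _ (∧-conicalʳ (𝓑 B) _ B∋ij)) , lookup⇒[]= j B (∧-conicalʳ _ _ (∧-conicalʳ (𝓑 B) _ B∋ij))
  ... | inj₂ none = ⊥-elim (¬parallel (¬loopᵢ , ¬loopⱼ , i≢j , λ B B∈𝓑 i∈B j∈B →
    true≢false (subst₂ (λ b c → b ∧ (c ∧ true) ≡ false) B∈𝓑 ([]=⇒lookup i∈B)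
      (subst (λ c → 𝓑 B ∧ (lookup B i ∧ c) ≡ false) ([]=⇒lookup j∈B) (none B)))))

  basis-∋∌ : ∀ {i j B₁ B₂} → i ≢ j → 𝓑 B₁ ≡ true → i ∈ B₁ → j ∈ B₁ → 𝓑 B₂ ≡ true → j ∉ B₂ →
    ∃ λ B → 𝓑 B ≡ true × i ∈ B × j ∉ B
  basis-∋∌ {i} {j} {B₁} {B₂} i≢j B₁∈𝓑 i∈B₁ j∈B₁ B₂∈𝓑 j∉B₂ with exchange B₁ B₂ B₁∈𝓑 B₂∈𝓑 j j∈B₁ j∉B₂
  ... | y , y∈B₂ , _ , B₃∈𝓑 = (B₁ ─ ⁅ j ⁆) ∪ ⁅ y ⁆ , B₃∈𝓑 , i∈B₃ , j∉B₃
    where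
    i∈B₃ : i ∈ (B₁ ─ ⁅ j ⁆) ∪ ⁅ y ⁆
    i∈B₃ = x∈p∪q⁺ (inj₁ (x∈p∧x∉q⇒x∈p─q i∈B₁ (i≢j ∘ x∈⁅y⁆⇒x≡y j)))
    j∉B₃ : j ∉ (B₁ ─ ⁅ j ⁆) ∪ ⁅ y ⁆
    j∉B₃ j∈B₃ with x∈p∪q⁻ (B₁ ─ ⁅ j ⁆) ⁅ y ⁆ j∈B₃
    ... | inj₁ j∈B₁─j = x∈q⇒x∉p─q B₁ ⁅ j ⁆ (x∈⁅x⁆ j) j∈B₁─j
    ... | inj₂ j∈⁅y⁆  = j∉B₂ (subst (_∈ B₂) (sym (x∈⁅y⁆⇒x≡y y j∈⁅y⁆)) y∈B₂)

==-refl : ∀ x → x == x ≡ true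
==-refl true  = refl
==-refl false = refl

inClass-intro : ∀ {n} {𝓑 : BasisFamily n} {i j B} → 𝓑 B ≡ true → ∀ {a c} → lookup B i ≡ a → lookup B j ≡ c →
  inClass 𝓑 i j a c B ≡ true
inClass-intro {i = i} {j} {B} B∈𝓑 refl refl rewrite B∈𝓑 | ==-refl (lookup B i) | ==-refl (lookup B j) = refl

-- The sequence β(M_k)

+-≡-+⇒≤ : ∀ {x y z w} → x + y ≡ z + w → w ≤ y → x ≤ z
+-≡-+⇒≤ {x} {y} {z} {w} eq w≤y = +-cancelʳ-≤ w x z (≤-trans (+-monoʳ-≤ x w≤y) (≤-reflexive eq))

module _ {N Q h : ℕ → ℕ} {s a e : ℕ} (1≤s : 1 ≤ s) (h/Q-decreasing : ∀ k → h (suc k) * Q k ≤ h k * Q (suc k)) where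

  decreasing-above : (∀ k → N k * s ≡ a * Q k + e * h k) → ∀ k → N (suc k) * Q k ≤ N k * Q (suc k)
  decreasing-above N≡ k = *-cancelˡ-≤ s {{>-nonZero 1≤s}} (begin
    s * (N (suc k) * Q k)                  ≡⟨ solve 3 (λ s n q → s :* (n :* q) := n :* s :* q) refl s (N (suc k)) (Q k) ⟩
    N (suc k) * s * Q k                    ≡⟨ cong (_* Q k) (N≡ (suc k)) ⟩
    (a * Q (suc k) + e * h (suc k)) * Q k  ≡⟨ solve 5 (λ a q′ e h′ q → (a :* q′ :+ e :* h′) :* q := a :* q :* q′ :+ e :* (h′ :* q)) refl a (Q (suc k)) e (h (suc k)) (Q k) ⟩
    a * Q k * Q (suc k) + e * (h (suc k) * Q k) ≤⟨ +-monoʳ-≤ (a * Q k * Q (suc k)) (*-monoʳ-≤ e (h/Q-decreasing k)) ⟩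
    a * Q k * Q (suc k) + e * (h k * Q (suc k)) ≡⟨ solve 5 (λ a q e h q′ → a :* q :* q′ :+ e :* (h :* q′) := (a :* q :+ e :* h) :* q′) refl a (Q k) e (h k) (Q (suc k)) ⟩
    (a * Q k + e * h k) * Q (suc k)        ≡⟨ cong (_* Q (suc k)) (N≡ k) ⟨
    N k * s * Q (suc k)                    ≡⟨ solve 3 (λ s n q → n :* s :* q := s :* (n :* q)) refl s (N k) (Q (suc k)) ⟩
    s * (N k * Q (suc k)) ∎)
    where open ≤-Reasoning

  increasing-below : (∀ k → N k * s + e * h k ≡ a * Q k) → ∀ k → N k * Q (suc k) ≤ N (suc k) * Q k
  increasing-below N≡ k = *-cancelˡ-≤ s {{>-nonZero 1≤s}} (+-≡-+⇒≤ (begin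
    s * (N k * Q (suc k)) + e * (h k * Q (suc k))
      ≡⟨ solve 5 (λ s n q′ e h → s :* (n :* q′) :+ e :* (h :* q′) := (n :* s :+ e :* h) :* q′) refl s (N k) (Q (suc k)) e (h k) ⟩
    (N k * s + e * h k) * Q (suc k)
      ≡⟨ cong (_* Q (suc k)) (N≡ k) ⟩
    a * Q k * Q (suc k)
      ≡⟨ solve 3 (λ a q q′ → a :* q :* q′ := a :* q′ :* q) refl a (Q k) (Q (suc k)) ⟩
    a * Q (suc k) * Q k
      ≡⟨ cong (_* Q k) (N≡ (suc k)) ⟨
    (N (suc k) * s + e * h (suc k)) * Q k
      ≡⟨ solve 5 (λ s n′ q e h′ → (n′ :* s :+ e :* h′) :* q := s :* (n′ :* q) :+ e :* (h′ :* q)) refl s (N (suc k)) (Q k) e (h (suc k)) ⟩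
    s * (N (suc k) * Q k) + e * (h (suc k) * Q k) ∎)
    (*-monoʳ-≤ e (h/Q-decreasing k)))
    where open ≡-Reasoning

module _ (A B C D : ℕ) where

  numer denom slack : ℕ → ℕ
  numer k = (D + k * B + k * C + k * k * A) * D
  denom k = (D + k * B) * (D + k * C)
  slack k = D * (k * (B + C) + D)

  β-formula : ℕ → ℚ
  β-formula k = frac (numer k) (denom k)

  α-formula : ℚ
  α-formula = frac (A * D) (B * C)

  1≤denom : 1 ≤ D → ∀ k → 1 ≤ denom k
  1≤denom 1≤D k = *-mono-≤ (≤-trans 1≤D (m≤m+n D (k * B))) (≤-trans 1≤D (m≤m+n D (k * C)))

  numer-identity : ∀ k → numer k * (B * C) + A * D * slack k ≡ A * D * denom k + B * C * slack k
  numer-identity k = solve 5 (λ A B C D k →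
    (D :+ k :* B :+ k :* C :+ k :* k :* A) :* D :* (B :* C) :+ A :* D :* (D :* (k :* (B :+ C) :+ D))
    := A :* D :* ((D :+ k :* B) :* (D :+ k :* C)) :+ B :* C :* (D :* (k :* (B :+ C) :+ D))) refl A B C D k

  slack/denom-decreasing : ∀ k → slack (suc k) * denom k ≤ slack k * denom (suc k)
  slack/denom-decreasing k = subst (slack (suc k) * denom k ≤_) (sym slack-identity) (m≤m+n _ _)
    where
    slack-identity : slack k * denom (suc k) ≡ slack (suc k) * denom k + D * ((k * k + k) * (B + C) * (B * C) + (2 * k + 1) * D * (B * C))
    slack-identity = solve 4 (λ B C D k →
      D :* (k :* (B :+ C) :+ D) :* ((D :+ (con 1 :+ k) :* B) :* (D :+ (con 1 :+ k) :* C))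
      := D :* ((con 1 :+ k) :* (B :+ C) :+ D) :* ((D :+ k :* B) :* (D :+ k :* C))
         :+ D :* ((k :* k :+ k) :* (B :+ C) :* (B :* C) :+ (con 2 :* k :+ con 1) :* D :* (B :* C))) refl B C D k

  numer-above : ∀ {E} → B * C ≡ A * D + E → ∀ k → numer k * (B * C) ≡ A * D * denom k + E * slack k
  numer-above {E} BC≡AD+E k = +-cancelʳ-≡ (A * D * slack k) _ _ (begin
    numer k * (B * C) + A * D * slack k          ≡⟨ numer-identity k ⟩
    A * D * denom k + B * C * slack k            ≡⟨ cong (λ x → A * D * denom k + x * slack k) BC≡AD+E ⟩
    A * D * denom k + (A * D + E) * slack k      ≡⟨ solve 4 (λ p x e s → p :+ (x :+ e) :* s := (p :+ e :* s) :+ x :* s) refl (A * D * denom k) (A * D) E (slack k) ⟩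
    A * D * denom k + E * slack k + A * D * slack k ∎)
    where open ≡-Reasoning

  numer-below : ∀ {E} → A * D ≡ B * C + E → ∀ k → numer k * (B * C) + E * slack k ≡ A * D * denom k
  numer-below {E} AD≡BC+E k = +-cancelʳ-≡ (B * C * slack k) _ _ (begin
    numer k * (B * C) + E * slack k + B * C * slack k ≡⟨ solve 4 (λ n e s x → n :+ e :* s :+ x :* s := n :+ (x :+ e) :* s) refl (numer k * (B * C)) E (slack k) (B * C) ⟩
    numer k * (B * C) + (B * C + E) * slack k      ≡⟨ cong (λ x → numer k * (B * C) + x * slack k) AD≡BC+E ⟨
    numer k * (B * C) + A * D * slack k            ≡⟨ numer-identity k ⟩
    A * D * denom k + B * C * slack k ∎)
    where open ≡-Reasoning

  slack-negligible : ∀ E d u k → 1 ≤ B → 1 ≤ C → 1 ≤ u → E * D * (B + C + D) * d ℕ.< k →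
    E * slack k * d ℕ.< u * (denom k * (B * C))
  slack-negligible E d u k@(suc k′) 1≤B 1≤C 1≤u bound = begin-strict
    E * slack k * d                     ≤⟨ *-monoˡ-≤ d (*-monoʳ-≤ E (*-monoʳ-≤ D slack≤)) ⟩
    E * (D * (k * (B + C + D))) * d     ≡⟨ solve 6 (λ e d k b c x → e :* (d :* (k :* (b :+ c :+ d))) :* x := k :* (e :* d :* (b :+ c :+ d) :* x)) refl E D k B C d ⟩
    k * (E * D * (B + C + D) * d)       <⟨ *-monoʳ-< k bound ⟩
    k * k                               ≤⟨ *-mono-≤ (k≤D+k* B 1≤B) (k≤D+k* C 1≤C) ⟩
    denom k                             ≤⟨ m≤m*n (denom k) (B * C) {{>-nonZero (*-mono-≤ 1≤B 1≤C)}} ⟩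
    denom k * (B * C)                   ≤⟨ m≤n*m (denom k * (B * C)) u {{>-nonZero 1≤u}} ⟩
    u * (denom k * (B * C)) ∎
    where
    open ≤-Reasoning
    slack≤ : k * (B + C) + D ≤ k * (B + C + D)
    slack≤ = ≤-trans (+-monoʳ-≤ (k * (B + C)) (m≤n*m D k))
                     (≤-reflexive (sym (*-distribˡ-+ k (B + C) D)))
    k≤D+k* : ∀ X → 1 ≤ X → k ≤ D + k * X
    k≤D+k* X 1≤X = ≤-trans (m≤m*n k X {{>-nonZero 1≤X}}) (m≤n+m (k * X) D)

frac-cong : ∀ {p q p′ q′} → 1 ≤ q → 1 ≤ q′ → p * q′ ≡ p′ * q → frac p q ≡ frac p′ q′
frac-cong {p} {suc q} {p′} {suc q′} _ _ eq = ℚₚ.fromℚᵘ-cong {ℚᵘ.mkℚᵘ (ℤ.+ p) q} {ℚᵘ.mkℚᵘ (ℤ.+ p′) q′} (ℚᵘ.*≡*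
  (trans (sym (ℤₚ.pos-* p (suc q′))) (trans (cong ℤ.+_ eq) (ℤₚ.pos-* p′ (suc q)))))

toℚᵘ-frac : ∀ p q → ℚ.toℚᵘ (frac p (suc q)) ℚᵘ.≃ ℚᵘ.mkℚᵘ (ℤ.+ p) q
toℚᵘ-frac p q = ℚₚ.toℚᵘ-fromℚᵘ (ℚᵘ.mkℚᵘ (ℤ.+ p) q)

frac-mono : ∀ {p q p′ q′} → 1 ≤ q → 1 ≤ q′ → p * q′ ≤ p′ * q → frac p q ≤ℚ frac p′ q′
frac-mono {p} {suc q} {p′} {suc q′} _ _ le = ℚₚ.toℚᵘ-cancel-≤
  (ℚᵘₚ.≤-respʳ-≃ (ℚᵘₚ.≃-sym (toℚᵘ-frac p′ q′)) (ℚᵘₚ.≤-respˡ-≃ (ℚᵘₚ.≃-sym (toℚᵘ-frac p q))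
    (ℚᵘ.*≤* (subst₂ ℤ._≤_ (ℤₚ.pos-* p (suc q′)) (ℤₚ.pos-* p′ (suc q)) (ℤ.+≤+ le)))))

frac<frac+ : ∀ {p q p′ q′} ε → 0ℚ < ε → 1 ≤ q → 1 ≤ q′ →
  p * (q′ * ℚ.↧ₙ ε) ℕ.< (p′ * ℚ.↧ₙ ε + ℤ.∣ ℚ.↥ ε ∣ * q′) * q → frac p q < frac p′ q′ ℚ.+ ε
frac<frac+ {p} {suc q} {p′} {suc q′} ε@(ℚ.mkℚ (ℤ.+ suc u) d _) _ _ _ lt = ℚₚ.toℚᵘ-cancel-<
  (ℚᵘₚ.<-respʳ-≃ (ℚᵘₚ.≃-sym toℚᵘ-rhs) (ℚᵘₚ.<-respˡ-≃ (ℚᵘₚ.≃-sym (toℚᵘ-frac p q)) (ℚᵘ.*<* (subst₂ ℤ._<_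
    (ℤₚ.pos-* p (suc q′ * suc d))
    (trans (ℤₚ.pos-* (p′ * suc d + suc u * suc q′) (suc q))
           (cong (ℤ._* ℤ.+ suc q) (trans (ℤₚ.pos-+ (p′ * suc d) (suc u * suc q′))
                                         (cong₂ ℤ._+_ (ℤₚ.pos-* p′ (suc d)) (ℤₚ.pos-* (suc u) (suc q′))))))
    (ℤ.+<+ lt)))))
  where
  toℚᵘ-rhs : ℚ.toℚᵘ (frac p′ (suc q′) ℚ.+ ε) ℚᵘ.≃ ℚᵘ.mkℚᵘ (ℤ.+ p′) q′ ℚᵘ.+ ℚᵘ.mkℚᵘ (ℤ.+ suc u) d
  toℚᵘ-rhs = ℚᵘₚ.≃-trans (ℚₚ.toℚᵘ-homo-+ (frac p′ (suc q′)) ε) (ℚᵘₚ.+-congˡ (ℚᵘ.mkℚᵘ (ℤ.+ suc u) d) (toℚᵘ-frac p′ q′))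
frac<frac+ (ℚ.mkℚ (ℤ.+ zero) _ _) (ℚ.*<* (ℤ.+<+ ())) _ _ _
frac<frac+ (ℚ.mkℚ ℤ.-[1+ _ ] _ _) (ℚ.*<* ()) _ _ _

∣p-q∣≡∣q-p∣ : ∀ p q → ∣ p - q ∣ ≡ ∣ q - p ∣
∣p-q∣≡∣q-p∣ p q = trans
  (cong ∣_∣ (sym (trans (⁻¹-anti-homo-∙ q (ℚ.- p)) (cong (ℚ._+ ℚ.- q) (⁻¹-involutive p)))))
  (ℚₚ.∣-p∣≡∣p∣ (q - p))

q≤p<q+ε⇒∣p-q∣<ε : ∀ {p q ε} → q ≤ℚ p → p < q ℚ.+ ε → ∣ p - q ∣ < ε
q≤p<q+ε⇒∣p-q∣<ε {p} {q} {ε} q≤p p<q+ε = subst (_< ε) (sym (ℚₚ.0≤p⇒∣p∣≡p 0≤p-q)) p-q<ε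
  where
  0≤p-q : 0ℚ ≤ℚ p - q
  0≤p-q = subst (_≤ℚ p - q) (ℚₚ.+-inverseʳ q) (ℚₚ.+-monoˡ-≤ (ℚ.- q) q≤p)
  q+ε-q≡ε : q ℚ.+ ε - q ≡ ε
  q+ε-q≡ε = begin
    q ℚ.+ ε - q       ≡⟨ cong (ℚ._+ ℚ.- q) (ℚₚ.+-comm q ε) ⟩
    ε ℚ.+ q - q       ≡⟨ ℚₚ.+-assoc ε q (ℚ.- q) ⟩
    ε ℚ.+ (q - q)     ≡⟨ cong (ε ℚ.+_) (ℚₚ.+-inverseʳ q) ⟩
    ε ℚ.+ 0ℚ          ≡⟨ ℚₚ.+-identityʳ ε ⟩
    ε ∎
    where open ≡-Reasoning
  p-q<ε : p - q < ε
  p-q<ε = subst (p - q <_) q+ε-q≡ε (ℚₚ.+-monoˡ-< (ℚ.- q) p<q+ε)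

frac-approx : ∀ {p q p′ q′ g} ε → 0ℚ < ε → 1 ≤ q → 1 ≤ q′ → p * q′ ≡ p′ * q + g →
  g * ℚ.↧ₙ ε ℕ.< ℤ.∣ ℚ.↥ ε ∣ * (q * q′) → ∣ frac p q - frac p′ q′ ∣ < ε
frac-approx {p} {q} {p′} {q′} {g} ε 0<ε 1≤q 1≤q′ pq′≡p′q+g g-small = q≤p<q+ε⇒∣p-q∣<ε
  (frac-mono 1≤q′ 1≤q (subst (p′ * q ≤_) (sym pq′≡p′q+g) (m≤m+n (p′ * q) g)))
  (frac<frac+ ε 0<ε 1≤q 1≤q′ (begin-strict
    p * (q′ * d)                 ≡⟨ *-assoc p q′ d ⟨
    p * q′ * d                   ≡⟨ cong (_* d) pq′≡p′q+g ⟩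
    (p′ * q + g) * d             ≡⟨ *-distribʳ-+ d (p′ * q) g ⟩
    p′ * q * d + g * d           <⟨ +-monoʳ-< (p′ * q * d) g-small ⟩
    p′ * q * d + u * (q * q′)    ≡⟨ solve 5 (λ p′ q d u q′ → p′ :* q :* d :+ u :* (q :* q′) := (p′ :* d :+ u :* q′) :* q) refl p′ q d u q′ ⟩
    (p′ * d + u * q′) * q ∎))
  where
  open ≤-Reasoning
  d = ℚ.↧ₙ ε
  u = ℤ.∣ ℚ.↥ ε ∣

module _ (A B C D : ℕ) (1≤B : 1 ≤ B) (1≤C : 1 ≤ C) (1≤D : 1 ≤ D) where

  private
    1≤BC : 1 ≤ B * C
    1≤BC = *-mono-≤ 1≤B 1≤C

    threshold : ℕ → ℚ → ℕ
    threshold E ε = suc (E * D * (B + C + D) * ℚ.↧ₙ ε)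

    1≤∣↥ε∣ : ∀ ε → 0ℚ < ε → 1 ≤ ℤ.∣ ℚ.↥ ε ∣
    1≤∣↥ε∣ (ℚ.mkℚ (ℤ.+ suc _) _ _) _                    = s≤s z≤n
    1≤∣↥ε∣ (ℚ.mkℚ (ℤ.+ zero) _ _)  (ℚ.*<* (ℤ.+<+ ()))
    1≤∣↥ε∣ (ℚ.mkℚ ℤ.-[1+ _ ] _ _)  (ℚ.*<* ())

  β-formula-monotone : (∀ k → β-formula A B C D k ≤ℚ β-formula A B C D (suc k))
                     ⊎ (∀ k → β-formula A B C D (suc k) ≤ℚ β-formula A B C D k)
  β-formula-monotone with ≤-total (A * D) (B * C)
  ... | inj₁ AD≤BC = inj₂ λ k → frac-mono (1≤denom A B C D 1≤D (suc k)) (1≤denom A B C D 1≤D k)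
    (decreasing-above {numer A B C D} {denom A B C D} {slack A B C D} {B * C} {A * D} {B * C ∸ A * D}
      1≤BC (slack/denom-decreasing A B C D) (numer-above A B C D (sym (m+[n∸m]≡n AD≤BC))) k)
  ... | inj₂ BC≤AD = inj₁ λ k → frac-mono (1≤denom A B C D 1≤D k) (1≤denom A B C D 1≤D (suc k))
    (increasing-below {numer A B C D} {denom A B C D} {slack A B C D} {B * C} {A * D} {A * D ∸ B * C}
      1≤BC (slack/denom-decreasing A B C D) (numer-below A B C D (sym (m+[n∸m]≡n BC≤AD))) k)

  β-formula-converges : ∀ ε → 0ℚ < ε → Σ ℕ λ N → ∀ k → N ≤ k → ∣ β-formula A B C D k - α-formula A B C D ∣ < ε
  β-formula-converges ε 0<ε with ≤-total (A * D) (B * C)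
  ... | inj₁ AD≤BC = threshold (B * C ∸ A * D) ε , λ k N≤k →
    frac-approx ε 0<ε (1≤denom A B C D 1≤D k) 1≤BC
      (numer-above A B C D (sym (m+[n∸m]≡n AD≤BC)) k)
      (slack-negligible A B C D (B * C ∸ A * D) (ℚ.↧ₙ ε) _ k 1≤B 1≤C (1≤∣↥ε∣ ε 0<ε) N≤k)
  ... | inj₂ BC≤AD = threshold (A * D ∸ B * C) ε , λ k N≤k →
    subst (_< ε) (∣p-q∣≡∣q-p∣ (α-formula A B C D) (β-formula A B C D k)) (frac-approx ε 0<ε 1≤BC (1≤denom A B C D 1≤D k)
      (sym (numer-below A B C D (sym (m+[n∸m]≡n BC≤AD)) k))
      (subst ((A * D ∸ B * C) * slack A B C D k * ℚ.↧ₙ ε ℕ.<_) (cong (ℤ.∣ ℚ.↥ ε ∣ *_) (*-comm (denom A B C D k) (B * C)))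
        (slack-negligible A B C D (A * D ∸ B * C) (ℚ.↧ₙ ε) _ k 1≤B 1≤C (1≤∣↥ε∣ ε 0<ε) N≤k)))

record ClassDecomposition {m} (𝓑 : BasisFamily m) (a c : Fin m) (X : Bool → Bool → ℕ) : Set where
  field
    b≡   : b 𝓑 ≡ (X true true + X true false) + (X false true + X false false)
    bₐ≡  : bₑ 𝓑 a ≡ X true true + X true false
    b꜀≡  : bₑ 𝓑 c ≡ X true true + X false true
    bₐ꜀≡ : bₑₑ 𝓑 a c ≡ X true true
    b꜀ₐ≡ : bₑₑ 𝓑 c a ≡ X true true

module _ {m} {𝓑 : BasisFamily m} {a c : Fin m} {X : Bool → Bool → ℕ} (dec : ClassDecomposition 𝓑 a c X) where
  open ClassDecomposition dec

  α≡frac : α 𝓑 a c ≡ frac (X false false * X true true) (X true false * X false true)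
  α≡frac = cong₂ frac (cong₂ _*_ b^≡ bₐ꜀≡) (cong₂ _*_ bₐ^≡ b꜀^≡)
    where
    bₐ^≡ : bₑ^ 𝓑 a c ≡ X true false
    bₐ^≡ = trans (cong₂ _∸_ bₐ≡ bₐ꜀≡) (m+n∸m≡n (X true true) (X true false))
    b꜀^≡ : bₑ^ 𝓑 c a ≡ X false true
    b꜀^≡ = trans (cong₂ _∸_ b꜀≡ b꜀ₐ≡) (m+n∸m≡n (X true true) (X false true))
    b^≡ : b^ 𝓑 a c ≡ X false false
    b^≡ = begin
      b 𝓑 ∸ bₑ 𝓑 a ∸ bₑ^ 𝓑 c a
        ≡⟨ cong₂ (λ x y → x ∸ bₑ 𝓑 a ∸ y) b≡ b꜀^≡ ⟩
      (X true true + X true false) + (X false true + X false false) ∸ bₑ 𝓑 a ∸ X false true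
        ≡⟨ cong (λ x → (X true true + X true false) + (X false true + X false false) ∸ x ∸ X false true) bₐ≡ ⟩
      (X true true + X true false) + (X false true + X false false) ∸ (X true true + X true false) ∸ X false true
        ≡⟨ cong (_∸ X false true) (m+n∸m≡n (X true true + X true false) (X false true + X false false)) ⟩
      (X false true + X false false) ∸ X false true
        ≡⟨ m+n∸m≡n (X false true) (X false false) ⟩
      X false false ∎
      where open ≡-Reasoning

  β≡frac : β 𝓑 a c ≡ frac (((X true true + X true false) + (X false true + X false false)) * X true true)
                           ((X true true + X true false) * (X true true + X false true))
  β≡frac = cong₂ frac (cong₂ _*_ b≡ bₐ꜀≡) (cong₂ _*_ bₐ≡ b꜀≡)

decomposition-M : ∀ {n} (𝓑 : BasisFamily n) (i j : Fin n) → ClassDecomposition 𝓑 i j (classWeight 𝓑 i j (λ _ → 1))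
decomposition-M 𝓑 i j = record
  { b≡   = trans (count≡weighted 𝓑) (weighted-bases 𝓑 i j (λ _ → 1))
  ; bₐ≡  = trans (count≡weighted (λ S → 𝓑 S ∧ mem i S)) (weighted-bases-∋i 𝓑 i j (λ _ → 1))
  ; b꜀≡  = trans (count≡weighted (λ S → 𝓑 S ∧ mem j S)) (weighted-bases-∋j 𝓑 i j (λ _ → 1))
  ; bₐ꜀≡ = count≡weighted (λ S → 𝓑 S ∧ mem i S ∧ mem j S)
  ; b꜀ₐ≡ = trans (count≡weighted (λ S → 𝓑 S ∧ mem j S ∧ mem i S)) (weighted-bases-∋ji 𝓑 i j (λ _ → 1))
  }

decomposition-Mk : ∀ {n} (𝓑 : BasisFamily n) (i j : Fin n) k →
  ClassDecomposition (Mk-bases 𝓑 i j k) (emb k i j i) (emb k i j j) (classWeight 𝓑 i j (weightMk 𝓑 i j k))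
decomposition-Mk 𝓑 i j k = record
  { b≡   = trans (count-Mk-bases 𝓑 i j k) (weighted-bases 𝓑 i j ω)
  ; bₐ≡  = trans (count-Mk-bases-∧ 𝓑 i j k _ (λ T → lookup T i) memᵢ) (weighted-bases-∋i 𝓑 i j ω)
  ; b꜀≡  = trans (count-Mk-bases-∧ 𝓑 i j k _ (λ T → lookup T j) memⱼ) (weighted-bases-∋j 𝓑 i j ω)
  ; bₐ꜀≡ = count-Mk-bases-∧ 𝓑 i j k _ (λ T → lookup T i ∧ lookup T j) (λ S → cong₂ _∧_ (memᵢ S) (memⱼ S))
  ; b꜀ₐ≡ = trans (count-Mk-bases-∧ 𝓑 i j k _ (λ T → lookup T j ∧ lookup T i) (λ S → cong₂ _∧_ (memⱼ S) (memᵢ S)))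
                 (weighted-bases-∋ji 𝓑 i j ω)
  }
  where
  ω = weightMk 𝓑 i j k
  memᵢ = mem-emb k i j i (inj₁ refl)
  memⱼ = mem-emb k i j j (inj₂ refl)

module _ {k R : ℕ} (1≤k : 1 ≤ k) {x X : Bool → Bool → ℕ}
         (scaled : ∀ a c → x a c * (k ^ 𝟙 a * k ^ 𝟙 c) ≡ R * X a c) where

  private
    A B C D : ℕ
    A = X false false
    B = X true false
    C = X false true
    D = X true true
    x₀₀ x₁₀ x₀₁ x₁₁ : ℕ
    x₀₀ = x false false
    x₁₀ = x true false
    x₀₁ = x false true
    x₁₁ = x true true
    1≤k*k : 1 ≤ k * k
    1≤k*k = *-mono-≤ 1≤k 1≤k

  cross-ratio-scaled : x₀₀ * x₁₁ * (B * C) ≡ A * D * (x₁₀ * x₀₁)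
  cross-ratio-scaled = *-cancelˡ-≡ _ _ (k * k) {{>-nonZero 1≤k*k}} (begin
    k * k * (x₀₀ * x₁₁ * (B * C))
      ≡⟨ solve 5 (λ k x₀₀ x₁₁ b c → k :* k :* (x₀₀ :* x₁₁ :* (b :* c)) := (x₀₀ :* (con 1 :* con 1)) :* (x₁₁ :* ((k :* con 1) :* (k :* con 1))) :* (b :* c)) refl k x₀₀ x₁₁ B C ⟩
    x₀₀ * (1 * 1) * (x₁₁ * ((k * 1) * (k * 1))) * (B * C)
      ≡⟨ cong₂ (λ u v → u * v * (B * C)) (scaled false false) (scaled true true) ⟩
    R * A * (R * D) * (B * C)
      ≡⟨ solve 5 (λ r a d b c → r :* a :* (r :* d) :* (b :* c) := a :* d :* ((r :* b) :* (r :* c))) refl R A D B C ⟩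
    A * D * (R * B * (R * C))
      ≡⟨ cong₂ (λ u v → A * D * (u * v)) (scaled true false) (scaled false true) ⟨
    A * D * (x₁₀ * ((k * 1) * 1) * (x₀₁ * (1 * (k * 1))))
      ≡⟨ solve 5 (λ k a d x₁₀ x₀₁ → a :* d :* (x₁₀ :* ((k :* con 1) :* con 1) :* (x₀₁ :* (con 1 :* (k :* con 1)))) := k :* k :* (a :* d :* (x₁₀ :* x₀₁))) refl k A D x₁₀ x₀₁ ⟩
    k * k * (A * D * (x₁₀ * x₀₁)) ∎)
    where open ≡-Reasoning

  total-ratio-scaled : ((x₁₁ + x₁₀) + (x₀₁ + x₀₀)) * x₁₁ * denom A B C D k ≡ numer A B C D k * ((x₁₁ + x₁₀) * (x₁₁ + x₀₁))
  total-ratio-scaled = *-cancelˡ-≡ _ _ (k * k * (k * k)) {{>-nonZero (*-mono-≤ 1≤k*k 1≤k*k)}} (begin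
    k * k * (k * k) * (total * x₁₁ * denom A B C D k)
      ≡⟨ solve 5 (λ k t x₁₁ q x → k :* k :* (k :* k) :* (t :* x₁₁ :* q) := (k :* k :* t) :* (x₁₁ :* ((k :* con 1) :* (k :* con 1))) :* q) refl k total x₁₁ (denom A B C D k) k ⟩
    k * k * total * (x₁₁ * ((k * 1) * (k * 1))) * denom A B C D k
      ≡⟨ cong₂ (λ u v → u * v * denom A B C D k) total-scaled (scaled true true) ⟩
    R * P * (R * D) * ((D + k * B) * (D + k * C))
      ≡⟨ solve 6 (λ r p d u v x → r :* p :* (r :* d) :* (u :* v) := p :* d :* ((r :* u) :* (r :* v))) refl R P D (D + k * B) (D + k * C) R ⟩
    P * D * (R * (D + k * B) * (R * (D + k * C)))
      ≡⟨ cong₂ (λ u v → P * D * (u * v)) with-i with-j ⟨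
    P * D * (k * k * (x₁₁ + x₁₀) * (k * k * (x₁₁ + x₀₁)))
      ≡⟨ solve 6 (λ k p d u v x → p :* d :* (k :* k :* u :* (k :* k :* v)) := k :* k :* (k :* k) :* (p :* d :* (u :* v))) refl k P D (x₁₁ + x₁₀) (x₁₁ + x₀₁) k ⟩
    k * k * (k * k) * (P * D * ((x₁₁ + x₁₀) * (x₁₁ + x₀₁))) ∎)
    where
    open ≡-Reasoning
    total = (x₁₁ + x₁₀) + (x₀₁ + x₀₀)
    P = D + k * B + k * C + k * k * A
    total-scaled : k * k * total ≡ R * P
    total-scaled = begin
      k * k * total
        ≡⟨ solve 5 (λ k x₁₁ x₁₀ x₀₁ x₀₀ → k :* k :* ((x₁₁ :+ x₁₀) :+ (x₀₁ :+ x₀₀)) := x₁₁ :* ((k :* con 1) :* (k :* con 1)) :+ k :* (x₁₀ :* ((k :* con 1) :* con 1)) :+ k :* (x₀₁ :* (con 1 :* (k :* con 1))) :+ k :* k :* (x₀₀ :* (con 1 :* con 1))) refl k x₁₁ x₁₀ x₀₁ x₀₀ ⟩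
      x₁₁ * ((k * 1) * (k * 1)) + k * (x₁₀ * ((k * 1) * 1)) + k * (x₀₁ * (1 * (k * 1))) + k * k * (x₀₀ * (1 * 1))
        ≡⟨ cong₂ _+_ (cong₂ _+_ (cong₂ _+_ (scaled true true) (cong (k *_) (scaled true false))) (cong (k *_) (scaled false true))) (cong (k * k *_) (scaled false false)) ⟩
      R * D + k * (R * B) + k * (R * C) + k * k * (R * A)
        ≡⟨ solve 6 (λ r d k b c a → r :* d :+ k :* (r :* b) :+ k :* (r :* c) :+ k :* k :* (r :* a) := r :* (d :+ k :* b :+ k :* c :+ k :* k :* a)) refl R D k B C A ⟩
      R * P ∎
    with-i : k * k * (x₁₁ + x₁₀) ≡ R * (D + k * B)
    with-i = begin
      k * k * (x₁₁ + x₁₀)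
        ≡⟨ solve 3 (λ k x₁₁ x₁₀ → k :* k :* (x₁₁ :+ x₁₀) := x₁₁ :* ((k :* con 1) :* (k :* con 1)) :+ k :* (x₁₀ :* ((k :* con 1) :* con 1))) refl k x₁₁ x₁₀ ⟩
      x₁₁ * ((k * 1) * (k * 1)) + k * (x₁₀ * ((k * 1) * 1))
        ≡⟨ cong₂ _+_ (scaled true true) (cong (k *_) (scaled true false)) ⟩
      R * D + k * (R * B)
        ≡⟨ solve 4 (λ r d k b → r :* d :+ k :* (r :* b) := r :* (d :+ k :* b)) refl R D k B ⟩
      R * (D + k * B) ∎
    with-j : k * k * (x₁₁ + x₀₁) ≡ R * (D + k * C)
    with-j = begin
      k * k * (x₁₁ + x₀₁)
        ≡⟨ solve 3 (λ k x₁₁ x₀₁ → k :* k :* (x₁₁ :+ x₀₁) := x₁₁ :* ((k :* con 1) :* (k :* con 1)) :+ k :* (x₀₁ :* (con 1 :* (k :* con 1)))) refl k x₁₁ x₀₁ ⟩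
      x₁₁ * ((k * 1) * (k * 1)) + k * (x₀₁ * (1 * (k * 1)))
        ≡⟨ cong₂ _+_ (scaled true true) (cong (k *_) (scaled false true)) ⟩
      R * D + k * (R * C)
        ≡⟨ solve 4 (λ r d k c → r :* d :+ k :* (r :* c) := r :* (d :+ k :* c)) refl R D k C ⟩
      R * (D + k * C) ∎

1≤m*n⇒1≤m : ∀ {m n} → 1 ≤ m * n → 1 ≤ m
1≤m*n⇒1≤m {suc m} _ = s≤s z≤n

1≤m^n : ∀ {m} n → 1 ≤ m → 1 ≤ m ^ n
1≤m^n n 1≤m = subst (_≤ _ ^ n) (^-zeroˡ n) (^-monoˡ-≤ n 1≤m)

module _ {n} {𝓑 : BasisFamily n} (M : IsMatroid 𝓑) {i j : Fin n} (i≢j : i ≢ j) where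

  private
    nonempty : ∀ {B a c} → 𝓑 B ≡ true → lookup B i ≡ a → lookup B j ≡ c → 1 ≤ classWeight 𝓑 i j (λ _ → 1) a c
    nonempty {B} {a} {c} B∈𝓑 Bᵢ Bⱼ = term≤weighted (inClass 𝓑 i j a c) (λ _ → 1) B (inClass-intro {𝓑 = 𝓑} {i} {j} {B} B∈𝓑 Bᵢ Bⱼ)

  classes-nonempty : ¬ IsLoop 𝓑 i → ¬ IsLoop 𝓑 j → ¬ IsColoop 𝓑 i → ¬ IsColoop 𝓑 j → ¬ Parallel 𝓑 i j →
    1 ≤ classWeight 𝓑 i j (λ _ → 1) true true ×
    1 ≤ classWeight 𝓑 i j (λ _ → 1) true false ×
    1 ≤ classWeight 𝓑 i j (λ _ → 1) false true
  classes-nonempty ¬loopᵢ ¬loopⱼ ¬coloopᵢ ¬coloopⱼ ¬parallel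
    with basis-∋∋ M i≢j ¬loopᵢ ¬loopⱼ ¬parallel | basis-∌ M ¬coloopᵢ | basis-∌ M ¬coloopⱼ
  ... | B₁ , B₁∈𝓑 , i∈B₁ , j∈B₁ | _ , Bᵢ∈𝓑 , i∉Bᵢ | _ , Bⱼ∈𝓑 , j∉Bⱼ
    with basis-∋∌ M i≢j B₁∈𝓑 i∈B₁ j∈B₁ Bⱼ∈𝓑 j∉Bⱼ | basis-∋∌ M (i≢j ∘ sym) B₁∈𝓑 j∈B₁ i∈B₁ Bᵢ∈𝓑 i∉Bᵢ
  ... | _ , B₂∈𝓑 , i∈B₂ , j∉B₂ | _ , B₃∈𝓑 , j∈B₃ , i∉B₃ =
    nonempty B₁∈𝓑 ([]=⇒lookup i∈B₁) ([]=⇒lookup j∈B₁) ,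
    nonempty B₂∈𝓑 ([]=⇒lookup i∈B₂) (∉⇒lookup≡false j∉B₂) ,
    nonempty B₃∈𝓑 (∉⇒lookup≡false i∉B₃) ([]=⇒lookup j∈B₃)

module _ {n} (𝓑 : BasisFamily n) (i j : Fin n) {r} (rank : HasRank 𝓑 r) (i≢j : i ≢ j) (k : ℕ) (1≤k : 1 ≤ k) where

  private
    X x : Bool → Bool → ℕ
    X = classWeight 𝓑 i j (λ _ → 1)
    x = classWeight 𝓑 i j (weightMk 𝓑 i j k)
    A B C D : ℕ
    A = X false false
    B = X true false
    C = X false true
    D = X true true
    scaled : ∀ a c → x a c * (k ^ 𝟙 a * k ^ 𝟙 c) ≡ k ^ r * X a c
    scaled = classWeight-Mk 𝓑 i j k r rank 1≤k i≢j
    1≤x : ∀ a c → 1 ≤ X a c → 1 ≤ x a c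
    1≤x a c 1≤X = 1≤m*n⇒1≤m (subst (1 ≤_) (sym (scaled a c)) (*-mono-≤ (1≤m^n r 1≤k) 1≤X))

  α-Mk≡α : 1 ≤ B → 1 ≤ C → α (Mk-bases 𝓑 i j k) (emb k i j i) (emb k i j j) ≡ α 𝓑 i j
  α-Mk≡α 1≤B 1≤C = begin
    α (Mk-bases 𝓑 i j k) (emb k i j i) (emb k i j j)
      ≡⟨ α≡frac (decomposition-Mk 𝓑 i j k) ⟩
    frac (x false false * x true true) (x true false * x false true)
      ≡⟨ frac-cong (*-mono-≤ (1≤x true false 1≤B) (1≤x false true 1≤C)) (*-mono-≤ 1≤B 1≤C) (cross-ratio-scaled {R = k ^ r} 1≤k {x} {X} scaled) ⟩
    frac (A * D) (B * C)
      ≡⟨ α≡frac (decomposition-M 𝓑 i j) ⟨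
    α 𝓑 i j ∎
    where open ≡-Reasoning

  β-Mk≡β-formula : 1 ≤ D → β (Mk-bases 𝓑 i j k) (emb k i j i) (emb k i j j) ≡ β-formula A B C D k
  β-Mk≡β-formula 1≤D = trans (β≡frac (decomposition-Mk 𝓑 i j k))
    (frac-cong (*-mono-≤ (≤-trans (1≤x true true 1≤D) (m≤m+n _ _)) (≤-trans (1≤x true true 1≤D) (m≤m+n _ _)))
               (1≤denom A B C D 1≤D k) (total-ratio-scaled {R = k ^ r} 1≤k {x} {X} scaled))

lemma2p6 : (n r : ℕ) (𝓑 : BasisFamily n) → IsMatroid 𝓑 → HasRank 𝓑 r →
  (i j : Fin n) → (i ≡ j → ⊥) →
  (IsLoop 𝓑 i → ⊥) → (IsLoop 𝓑 j → ⊥) →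
  (IsColoop 𝓑 i → ⊥) → (IsColoop 𝓑 j → ⊥) →
  (Parallel 𝓑 i j → ⊥) →
  ((k : ℕ) → 1 ≤ k →
    α (Mk-bases 𝓑 i j k) (emb k i j i) (emb k i j j) ≡ α 𝓑 i j)
  ×
  (((k : ℕ) → 1 ≤ k →
      β (Mk-bases 𝓑 i j k) (emb k i j i) (emb k i j j)
        ≤ℚ β (Mk-bases 𝓑 i j (suc k)) (emb (suc k) i j i) (emb (suc k) i j j))
    ⊎
    ((k : ℕ) → 1 ≤ k →
      β (Mk-bases 𝓑 i j (suc k)) (emb (suc k) i j i) (emb (suc k) i j j)
        ≤ℚ β (Mk-bases 𝓑 i j k) (emb k i j i) (emb k i j j)))
  ×
  ((ε : ℚ) → 0ℚ < ε → Σ ℕ λ N → (k : ℕ) → N ≤ k → 1 ≤ k →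
    ∣ β (Mk-bases 𝓑 i j k) (emb k i j i) (emb k i j j) - α 𝓑 i j ∣ < ε)
lemma2p6 n r 𝓑 M rank i j i≢j ¬loopᵢ ¬loopⱼ ¬coloopᵢ ¬coloopⱼ ¬parallel =
  (λ k 1≤k → α-Mk≡α 𝓑 i j rank i≢j k 1≤k 1≤B 1≤C) ,
  Sum.map (λ up k 1≤k → subst₂ _≤ℚ_ (sym (βₖ≡ k 1≤k)) (sym (βₖ≡ (suc k) (s≤s z≤n))) (up k))
          (λ down k 1≤k → subst₂ _≤ℚ_ (sym (βₖ≡ (suc k) (s≤s z≤n))) (sym (βₖ≡ k 1≤k)) (down k))
          (β-formula-monotone A B C D 1≤B 1≤C 1≤D) ,
  λ ε 0<ε → let (N , converges) = β-formula-converges A B C D 1≤B 1≤C 1≤D ε 0<ε in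
    N , λ k N≤k 1≤k → subst₂ (λ x y → ∣ x - y ∣ < ε) (sym (βₖ≡ k 1≤k)) (sym α≡α-formula) (converges k N≤k)
  where
  X = classWeight 𝓑 i j (λ _ → 1)
  A = X false false
  B = X true false
  C = X false true
  D = X true true
  nonempty = classes-nonempty M i≢j ¬loopᵢ ¬loopⱼ ¬coloopᵢ ¬coloopⱼ ¬parallel
  1≤D = proj₁ nonempty
  1≤B = proj₁ (proj₂ nonempty)
  1≤C = proj₂ (proj₂ nonempty)
  α≡α-formula : α 𝓑 i j ≡ α-formula A B C D
  α≡α-formula = α≡frac (decomposition-M 𝓑 i j)
  βₖ≡ : ∀ k → 1 ≤ k → β (Mk-bases 𝓑 i j k) (emb k i j i) (emb k i j j) ≡ β-formula A B C D k
  βₖ≡ k 1≤k = β-Mk≡β-formula 𝓑 i j rank i≢j k 1≤k 1≤D
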